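{- Let $G$ be a matroid on $[n]$ with no loops and no multiple points, $\mathbb{K}$ a field or commutative ring, $r\ge1$, and fix a linear order on $[n]$. Then the images in $A_r(G)$ of the monomials $e_S$, $S$ ranging over the $r$-nbb sets of $G$, form a linearly independent set.
   Context: $\mathcal{E}$ is the exterior algebra over $\mathbb{K}$ on $e_1,\dots,e_n$, $e_S=e_{i_1}\cdots e_{i_p}$ for $S=\{i_1<\dots<i_p\}$; $\partial(e_{i_1}\cdots e_{i_p})=\sum_k(-1)^{k-1}e_{i_1}\cdots\widehat{e_{i_k}}\cdots e_{i_p}$; $\mathcal{I}$ is the ideal generated by $\partial e_S$ for dependent $S$; $\mathcal{J}_r$ is the ideal generated by elements of $\mathcal{I}$ of degree $\le r$; $A_r(G)=\mathcal{E}/\mathcal{J}_r$. A subset of $[n]$ is $r$-closed if it contains the matroid closures of all its $p$-subsets for all $p\le r$; the $r$-closure of $S$ is the intersection of all $r$-closed sets containing $S$. An increasing subset $S=\{i_1<\dots<i_p\}$ is $r$-nbb if, for each $k$, $i_k$ is the smallest element of the $r$-closure of $\{i_k,\dots,i_p\}$. -}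

module Defs where

open import Level using (Level; _⊔_)
open import Algebra.Bundles using (CommutativeRing)
open import Data.Nat as ℕ using (ℕ; zero; suc)
open import Data.Bool using (Bool; true; false; if_then_else_)
open import Data.Fin as Fin using (Fin)
open import Data.Fin.Properties as FinP using ()
open import Data.Fin.Subset using (⊥; _─_; Subset; _∈_; _⊆_; _∪_; _∩_; ⁅_⁆; ∣_∣; inside; outside)
open import Data.Fin.Subset.Properties using (_∈?_)
open import Data.List using (List; []; _∷_; _++_; map; foldr; allFin; filter)
open import Data.List.Relation.Unary.All using (All)
open import Data.Vec using (Vec; []; _∷_; tabulate)
open import Data.Vec.Properties using (≡-dec)
open import Data.Bool.Properties using () renaming (_≟_ to _≟B_)
open import Data.Product using (Σ; _×_; _,_)
open import Relation.Nullary using (¬_; Dec; yes; no; does)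
open import Relation.Binary.PropositionalEquality using (_≡_; _≢_)

allSubsets : (m : ℕ) → List (Subset m)
allSubsets zero    = [] ∷ []
allSubsets (suc m) = map (inside ∷_) (allSubsets m) ++ map (outside ∷_) (allSubsets m)

_≟S_ : ∀ {m} (S T : Subset m) → Dec (S ≡ T)
_≟S_ = ≡-dec _≟B_

countL : ∀ {a} {A : Set a} → (A → Bool) → List A → ℕ
countL p []       = 0
countL p (x ∷ xs) = if p x then suc (countL p xs) else countL p xs

record Matroid (n : ℕ) : Set where
  field
    rk        : Subset n → ℕ
    rk-bound  : ∀ X → rk X ℕ.≤ ∣ X ∣
    rk-mono   : ∀ {X Y} → X ⊆ Y → rk X ℕ.≤ rk Y
    rk-submod : ∀ X Y → rk (X ∪ Y) ℕ.+ rk (X ∩ Y) ℕ.≤ rk X ℕ.+ rk Y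

module _ {n : ℕ} (G : Matroid n) where
  open Matroid G

  Loopless : Set
  Loopless = ∀ i → rk ⁅ i ⁆ ≡ 1

  NoMultiplePoints : Set
  NoMultiplePoints = ∀ i j → i ≢ j → rk (⁅ i ⁆ ∪ ⁅ j ⁆) ≡ 2

  Dependent : Subset n → Set
  Dependent S = rk S ℕ.< ∣ S ∣

  InClosure : Subset n → Fin n → Set
  InClosure X i = rk (X ∪ ⁅ i ⁆) ≡ rk X

  RClosed : ℕ → Subset n → Set
  RClosed r X = ∀ T → T ⊆ X → ∣ T ∣ ℕ.≤ r → ∀ i → InClosure T i → i ∈ X

  InRClosure : ℕ → Subset n → Fin n → Set
  InRClosure r S i = ∀ X → RClosed r X → S ⊆ X → i ∈ X

  upperPart : Subset n → Fin n → Subset n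
  upperPart S i = S ∩ tabulate (λ j → does (i Fin.≤? j))

  -- S = {i₁ < … < i_p} is r-nbb (w.r.t. the natural order on Fin n):
  -- each i_k is the least element of the r-closure of {i_k,…,i_p}
  NBB : ℕ → Subset n → Set
  NBB r S = ∀ i → i ∈ S → ∀ j → InRClosure r (upperPart S i) j → i Fin.≤ j

module Exterior {c ℓ : Level} (R : CommutativeRing c ℓ) (n : ℕ) where
  open CommutativeRing R

  -- an element of ℰ is its coefficient vector in the basis (e_S)_S
  Elt : Set c
  Elt = Subset n → Carrier

  _≈E_ : Elt → Elt → Set ℓ
  x ≈E y = ∀ S → x S ≈ y S

  zeroE : Elt
  zeroE _ = 0#

  _+E_ : Elt → Elt → Elt
  (x +E y) S = x S + y S

  _•_ : Carrier → Elt → Elt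
  (a • x) S = a * x S

  sumE : List Elt → Elt
  sumE = foldr _+E_ zeroE

  e : Subset n → Elt
  e S T with T ≟S S
  ... | yes _ = 1#
  ... | no  _ = 0#

  sgn : ℕ → Carrier
  sgn zero    = 1#
  sgn (suc k) = - sgn k

  elems : Subset n → List (Fin n)
  elems S = filter (_∈? S) (allFin n)

  inversions : Subset n → Subset n → ℕ
  inversions S T =
    foldr ℕ._+_ 0 (map (λ s → countL (λ t → does (t Fin.<? s)) (elems T)) (elems S))

  mulBasis : Subset n → Subset n → Elt
  mulBasis S T with (S ∩ T) ≟S ⊥
  ... | yes _ = sgn (inversions S T) • e (S ∪ T)
  ... | no  _ = zeroE

  infixl 7 _∧_
  _∧_ : Elt → Elt → Elt
  x ∧ y = sumE (map (λ S → sumE (map (λ T → (x S * y T) • mulBasis S T)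
                                     (allSubsets n)))
                    (allSubsets n))

  -- ∂ e_S = Σ_k (-1)^{k-1} e_{S - i_k}; the position k-1 of i ∈ S is
  -- the number of elements of S smaller than i
  ∂e : Subset n → Elt
  ∂e S = sumE (map (λ i → sgn (countL (λ j → does (j Fin.<? i)) (elems S)) • e (S ─ ⁅ i ⁆))
                   (elems S))

  linComb : (Subset n → Carrier) → Elt
  linComb coef = sumE (map (λ S → coef S • e S) (allSubsets n))

  DegLe : ℕ → Elt → Set ℓ
  DegLe r y = ∀ U → r ℕ.< ∣ U ∣ → y U ≈ 0#

  module _ (G : Matroid n) where

    InI : Elt → Set (c ⊔ ℓ)
    InI y = Σ (List (Elt × Subset n × Elt)) λ gs →
              All (λ { (_ , S , _) → Dependent G S }) gs
            × y ≈E sumE (map (λ { (a , S , b) → a ∧ ∂e S ∧ b }) gs)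

    InJ : ℕ → Elt → Set (c ⊔ ℓ)
    InJ r x = Σ (List (Elt × Elt × Elt)) λ gs →
                All (λ { (_ , y , _) → InI y × DegLe r y }) gs
              × x ≈E sumE (map (λ { (a , y , b) → a ∧ y ∧ b }) gs)

-- Induction along the colexicographic order of subsets reduces the claim to a single r-nbb set S.
-- The r-closures Y_s of the tails {t ∈ S | s ≤ t} are nested, so every point x gets a level:
-- 1 + the largest s ∈ S with x ∈ Y_s.  As each Y_s is r-closed and S is r-nbb, at most r + 1
-- points on pairwise distinct levels are independent.  Let φ send e_W to the sign of sorting W
-- by level when W has exactly one point on each level of S, and to 0 otherwise.  Then φ vanishes
-- on sets with two points on one level, and trading a point for another on the same level only
-- multiplies φ by (-1)^(number of points in between); both properties survive multiplication
-- by arbitrary elements on either side and truncation to degree ≤ r.  A dependent C with at most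
-- r + 1 points has two points on one level, and the two surviving terms of φ(∂ e_C) cancel, so
-- φ vanishes on 𝒥_r.  Any other set with one point on each level precedes S colexicographically,
-- so pairing φ with a relation among r-nbb monomials leaves ±c_S = 0.

module Submission where

open import Defs
open import Level using (Level)
open import Algebra.Bundles using (CommutativeRing)
open import Data.Nat using (ℕ; _≤_)
open import Data.Fin.Subset using (Subset)
open import Relation.Nullary using (¬_)

open import Data.Nat as ℕ using (zero; suc; z≤n; s≤s)
import Data.Nat.Properties as ℕₚ
open import Data.Nat.Induction using (<-rec)
open import Data.Nat.ListAction using (sum)
open import Data.Bool using (Bool; true; false; not; _∧_; _xor_; if_then_else_)
open import Data.Bool.Properties using (not-distribˡ-xor; xor-assoc; xor-same; xor-annihilates-not;
  xor-identityʳ; ∨-identityʳ; xor-∧-commutativeRing)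
  renaming (_≟_ to _≟ᵇ_)
open import Data.Empty using (⊥-elim)
open import Data.Fin as Fin using (Fin; zero; suc; toℕ)
import Data.Fin.Properties as Finₚ
open import Data.Fin.Subset using (_∈_; _∉_; _⊆_; _∪_; _∩_; _─_; _-_; ⁅_⁆; ∣_∣; ⊥; inside; outside)
open import Data.Fin.Subset.Properties using (_∈?_; x∈p∪q⁻; x∈p∪q⁺; x∈⁅x⁆; x∈⁅y⁆⇒x≡y; x∈p∩q⁺; x∈p∩q⁻; ∉⊥;
  nonempty?; Empty-unique; anySubset?; _⊆?_; p⊆p∪q; ∣p∣≤∣p∪q∣; ∣q∣≤∣p∪q∣; ∣⊥∣≡0; ∣⁅x⁆∣≡1; x∈p∧x≢y⇒x∈p-y;
  p─x─y≡p─y─x; ∪-identityˡ; ∪-identityʳ; ∪-assoc; ∪-comm; p─q⊆p; p─⊥≡p; ⊆-antisym; drop-there)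
open import Data.List using (List; []; _∷_; _++_; map; filter; allFin; tabulate)
open import Data.List.Properties using (map-tabulate; map-∘)
open import Data.List.Relation.Unary.All using (All; []; _∷_)
open import Data.Product using (∃; _×_; _,_; proj₁; proj₂)
open import Data.Sum using (_⊎_; inj₁; inj₂)
open import Data.Vec as Vec using ([]; _∷_; here; there)
import Data.Vec.Properties as Vecₚ
open import Function using (_∘_; case_of_)
import Relation.Binary.PropositionalEquality as ≡
open ≡ using (_≡_; _≢_; refl; cong; cong₂; subst; module ≡-Reasoning)
open import Relation.Nullary using (Dec; yes; no; does; ¬?)
open import Relation.Nullary.Decidable using (_→-dec_; _×-dec_; map′; decidable-stable; dec-true; dec-false)
open import Relation.Binary.Definitions using (tri<; tri≈; tri>)
import Algebra.Solver.Ring.Simple as RingSolver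
import Algebra.Solver.Ring.AlmostCommutativeRing as ACR

module XorSolver = RingSolver (ACR.fromCommutativeRing xor-∧-commutativeRing) _≟ᵇ_

x∉p⇒∣p∪⁅x⁆∣≡1+∣p∣ : ∀ {n} {x : Fin n} {p : Subset n} → x ∉ p → ∣ p ∪ ⁅ x ⁆ ∣ ≡ suc ∣ p ∣
x∉p⇒∣p∪⁅x⁆∣≡1+∣p∣ {x = zero}  {inside ∷ p}  x∉p = ⊥-elim (x∉p here)
x∉p⇒∣p∪⁅x⁆∣≡1+∣p∣ {x = zero}  {outside ∷ p} _   = cong (suc ∘ ∣_∣) (∪-identityʳ p)
x∉p⇒∣p∪⁅x⁆∣≡1+∣p∣ {x = suc x} {inside ∷ p}  x∉p = cong suc (x∉p⇒∣p∪⁅x⁆∣≡1+∣p∣ (x∉p ∘ there))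
x∉p⇒∣p∪⁅x⁆∣≡1+∣p∣ {x = suc x} {outside ∷ p} x∉p = x∉p⇒∣p∪⁅x⁆∣≡1+∣p∣ (x∉p ∘ there)

x∉p-x : ∀ {n} (p : Subset n) (x : Fin n) → x ∉ p - x
x∉p-x (inside ∷ p)  zero    ()
x∉p-x (outside ∷ p) zero    ()
x∉p-x (b ∷ p)       (suc x) (there x∈) = x∉p-x p x x∈

y∈p-x⇒y≢x : ∀ {n} (p : Subset n) {x y : Fin n} → y ∈ p - x → y ≢ x
y∈p-x⇒y≢x p {x} y∈ refl = x∉p-x p x y∈

x∈p⇒p-x∪⁅x⁆≡p : ∀ {n} {x : Fin n} {p : Subset n} → x ∈ p → (p - x) ∪ ⁅ x ⁆ ≡ p
x∈p⇒p-x∪⁅x⁆≡p {x = zero}  {inside ∷ p} here        = cong (inside ∷_) (≡.trans (∪-identityʳ (p ─ ⊥)) (p─⊥≡p p))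
x∈p⇒p-x∪⁅x⁆≡p {x = suc x} {b ∷ p}      (there x∈p) = cong₂ _∷_ (∨-identityʳ b) (x∈p⇒p-x∪⁅x⁆≡p x∈p)

x∈p⇒1+∣p-x∣≡∣p∣ : ∀ {n} {x : Fin n} {p : Subset n} → x ∈ p → suc ∣ p - x ∣ ≡ ∣ p ∣
x∈p⇒1+∣p-x∣≡∣p∣ {x = x} {p} x∈p =
  ≡.trans (≡.sym (x∉p⇒∣p∪⁅x⁆∣≡1+∣p∣ (x∉p-x p x))) (cong ∣_∣ (x∈p⇒p-x∪⁅x⁆≡p x∈p))

x∈p⇒x∈p∪⁅y⁆ : ∀ {n} {p : Subset n} {x y : Fin n} → x ∈ p → x ∈ p ∪ ⁅ y ⁆
x∈p⇒x∈p∪⁅y⁆ x∈p = x∈p∪q⁺ (inj₁ x∈p)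

x∈p∪⁅x⁆ : ∀ {n} {p : Subset n} {x : Fin n} → x ∈ p ∪ ⁅ x ⁆
x∈p∪⁅x⁆ {x = x} = x∈p∪q⁺ (inj₂ (x∈⁅x⁆ x))

x∈p∪⁅y⁆⁻ : ∀ {n} (p : Subset n) {x y : Fin n} → x ∈ p ∪ ⁅ y ⁆ → x ∈ p ⊎ x ≡ y
x∈p∪⁅y⁆⁻ p {y = y} x∈ with x∈p∪q⁻ p ⁅ y ⁆ x∈
... | inj₁ x∈p = inj₁ x∈p
... | inj₂ x∈y = inj₂ (x∈⁅y⁆⇒x≡y y x∈y)

x∉p∪q : ∀ {n} {p q : Subset n} {x : Fin n} → x ∉ p → x ∉ q → x ∉ p ∪ q
x∉p∪q {p = p} {q} x∉p x∉q x∈ with x∈p∪q⁻ p q x∈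
... | inj₁ x∈p = x∉p x∈p
... | inj₂ x∈q = x∉q x∈q

p∩q≡⊥⇒x∉q : ∀ {n} {p q : Subset n} {x : Fin n} → p ∩ q ≡ ⊥ → x ∈ p → x ∉ q
p∩q≡⊥⇒x∉q p∩q≡⊥ x∈p x∈q = ∉⊥ (subst (_ ∈_) p∩q≡⊥ (x∈p∩q⁺ (x∈p , x∈q)))

p∩q≢⊥⇒∃ : ∀ {n} (p q : Subset n) → p ∩ q ≢ ⊥ → ∃ λ x → x ∈ p × x ∈ q
p∩q≢⊥⇒∃ p q p∩q≢⊥ with nonempty? (p ∩ q)
... | yes (x , x∈p∩q) = x , x∈p∩q⁻ p q x∈p∩q
... | no  empty       = ⊥-elim (p∩q≢⊥ (Empty-unique empty))

disjoint⇒p∩q≡⊥ : ∀ {n} {p q : Subset n} → (∀ {x} → x ∈ p → x ∉ q) → p ∩ q ≡ ⊥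
disjoint⇒p∩q≡⊥ {p = p} {q} disjoint = Empty-unique λ (x , x∈) →
  let x∈p , x∈q = x∈p∩q⁻ p q x∈ in disjoint x∈p x∈q

x∉p⇒p∩⁅x⁆≡⊥ : ∀ {n} {x : Fin n} {p : Subset n} → x ∉ p → p ∩ ⁅ x ⁆ ≡ ⊥
x∉p⇒p∩⁅x⁆≡⊥ {p = p} x∉p = disjoint⇒p∩q≡⊥ λ y∈p y∈⁅x⁆ → x∉p (subst (_∈ p) (x∈⁅y⁆⇒x≡y _ y∈⁅x⁆) y∈p)

p∩q≡⊥⇒p∪⁅x⁆∩q≡⊥ : ∀ {n} {p q : Subset n} {x : Fin n} → p ∩ q ≡ ⊥ → x ∉ q → (p ∪ ⁅ x ⁆) ∩ q ≡ ⊥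
p∩q≡⊥⇒p∪⁅x⁆∩q≡⊥ {p = p} p∩q≡⊥ x∉q = disjoint⇒p∩q≡⊥ λ y∈ → case x∈p∪⁅y⁆⁻ p y∈ of λ where
  (inj₁ y∈p)  → p∩q≡⊥⇒x∉q p∩q≡⊥ y∈p
  (inj₂ refl) → x∉q

p∩q≡⊥⇒p∩q∪⁅x⁆≡⊥ : ∀ {n} {p q : Subset n} {x : Fin n} → p ∩ q ≡ ⊥ → x ∉ p → p ∩ (q ∪ ⁅ x ⁆) ≡ ⊥
p∩q≡⊥⇒p∩q∪⁅x⁆≡⊥ {q = q} p∩q≡⊥ x∉p = disjoint⇒p∩q≡⊥ λ y∈p y∈ → case x∈p∪⁅y⁆⁻ q y∈ of λ where
  (inj₁ y∈q)  → p∩q≡⊥⇒x∉q p∩q≡⊥ y∈p y∈q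
  (inj₂ refl) → x∉p y∈p

subsetOf : ∀ {n} {P : Fin n → Set} → (∀ x → Dec (P x)) → Subset n
subsetOf P? = Vec.tabulate (does ∘ P?)

∈subsetOf⁻ : ∀ {n} {P : Fin n → Set} (P? : ∀ x → Dec (P x)) {x} → x ∈ subsetOf P? → P x
∈subsetOf⁻ P? {zero} x∈ with P? zero | x∈
... | yes p | _ = p
... | no  _ | ()
∈subsetOf⁻ P? {suc x} (there x∈) = ∈subsetOf⁻ (P? ∘ suc) x∈

∈subsetOf⁺ : ∀ {n} {P : Fin n → Set} (P? : ∀ x → Dec (P x)) {x} → P x → x ∈ subsetOf P?
∈subsetOf⁺ P? {zero} p with P? zero
... | yes _  = here
... | no  ¬p = ⊥-elim (¬p p)
∈subsetOf⁺ P? {suc x} p = there (∈subsetOf⁺ (P? ∘ suc) p)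

∀-subset? : ∀ {n} {P : Subset n → Set} → (∀ X → Dec (P X)) → Dec (∀ X → P X)
∀-subset? P? with anySubset? (¬? ∘ P?)
... | yes (X , ¬PX) = no (λ ∀P → ¬PX (∀P X))
... | no  ¬∃¬P      = yes (λ X → decidable-stable (P? X) (λ ¬PX → ¬∃¬P (X , ¬PX)))

maxOver : ∀ {n} → (Fin n → ℕ) → ℕ
maxOver {zero}  f = 0
maxOver {suc n} f = f zero ℕ.⊔ maxOver (f ∘ suc)

f≤maxOver : ∀ {n} (f : Fin n → ℕ) x → f x ℕ.≤ maxOver f
f≤maxOver f zero    = ℕₚ.m≤m⊔n _ _
f≤maxOver f (suc x) = ℕₚ.≤-trans (f≤maxOver (f ∘ suc) x) (ℕₚ.m≤n⊔m _ _)

maxOver-attained : ∀ {n} (f : Fin n → ℕ) → maxOver f ≡ 0 ⊎ ∃ λ x → maxOver f ≡ f x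
maxOver-attained {zero}  f = inj₁ refl
maxOver-attained {suc n} f with ℕₚ.⊔-sel (f zero) (maxOver (f ∘ suc)) | maxOver-attained (f ∘ suc)
... | inj₁ eq | _              = inj₂ (zero , eq)
... | inj₂ eq | inj₁ eq₀       = inj₁ (≡.trans eq eq₀)
... | inj₂ eq | inj₂ (x , eqₓ) = inj₂ (suc x , ≡.trans eq eqₓ)

minimiser : ∀ {n} {P : Fin n → Set} → (∀ x → Dec (P x)) → (f : Fin n → ℕ) → ∃ P →
            ∃ λ x → P x × (∀ y → P y → f x ℕ.≤ f y)
minimiser {n} {P} P? f (x₀ , px₀) = <-rec Goal step (f x₀) x₀ px₀ refl
  where
  Goal : ℕ → Set
  Goal k = ∀ x → P x → f x ≡ k → ∃ λ x → P x × (∀ y → P y → f x ℕ.≤ f y)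
  step : ∀ k → (∀ {j} → j ℕ.< k → Goal j) → Goal k
  step k rec x px refl with Finₚ.any? (λ y → P? y ×-dec (f y ℕ.<? f x))
  ... | yes (y , py , fy<fx) = rec fy<fx y py refl
  ... | no  ¬smaller         = x , px , λ y py → ℕₚ.≮⇒≥ (λ fy<fx → ¬smaller (y , py , fy<fx))

elements : ∀ {n} → Subset n → List (Fin n)
elements {n} S = filter (_∈? S) (allFin n)

filter-∈?-map-suc : ∀ {n} b (S : Subset n) (xs : List (Fin n)) →
                    filter (_∈? (b ∷ S)) (map suc xs) ≡ map suc (filter (_∈? S) xs)
filter-∈?-map-suc b S []       = refl
filter-∈?-map-suc b S (x ∷ xs) with does (x ∈? S)
... | true  = cong (suc x ∷_) (filter-∈?-map-suc b S xs)
... | false = filter-∈?-map-suc b S xs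

elements-∷ : ∀ {n} b (S : Subset n) →
             elements (b ∷ S) ≡ (if b then zero ∷ map suc (elements S) else map suc (elements S))
elements-∷ {n} b S =
  ≡.trans (cong (filter (_∈? (b ∷ S)) ∘ (zero ∷_)) (≡.sym (map-tabulate (λ i → i) suc))) (head b)
  where
  head : ∀ b → filter (_∈? (b ∷ S)) (zero ∷ map suc (allFin n))
             ≡ (if b then zero ∷ map suc (elements S) else map suc (elements S))
  head true  = cong (zero ∷_) (filter-∈?-map-suc true S (allFin n))
  head false = filter-∈?-map-suc false S (allFin n)

-- Parities of counts, computed in Bool with xor as addition mod 2

parity : ℕ → Bool
parity zero    = false
parity (suc k) = not (parity k)

parity-+ : ∀ m n → parity (m ℕ.+ n) ≡ parity m xor parity n
parity-+ zero    n = refl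
parity-+ (suc m) n = ≡.trans (cong not (parity-+ m n)) (not-distribˡ-xor (parity m) (parity n))

oddCount : ∀ {n} → Subset n → (Fin n → Bool) → Bool
oddCount []      p = false
oddCount (b ∷ W) p = (b ∧ p zero) xor oddCount W (p ∘ suc)

oddCount-cong : ∀ {n} (W : Subset n) {p q : Fin n → Bool} →
                (∀ {x} → x ∈ W → p x ≡ q x) → oddCount W p ≡ oddCount W q
oddCount-cong []            eq = refl
oddCount-cong (inside ∷ W)  eq = cong₂ _xor_ (eq here) (oddCount-cong W (eq ∘ there))
oddCount-cong (outside ∷ W) eq = oddCount-cong W (eq ∘ there)

oddCount-xor : ∀ {n} (W : Subset n) (p q : Fin n → Bool) →
               oddCount W (λ x → p x xor q x) ≡ oddCount W p xor oddCount W q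
oddCount-xor []      p q = refl
oddCount-xor (b ∷ W) p q =
  ≡.trans (cong ((b ∧ (p zero xor q zero)) xor_) (oddCount-xor W (p ∘ suc) (q ∘ suc)))
          (distrib b (p zero) (q zero) (oddCount W (p ∘ suc)) (oddCount W (q ∘ suc)))
  where
  open XorSolver
  distrib : ∀ b x y X Y → (b ∧ (x xor y)) xor (X xor Y) ≡ ((b ∧ x) xor X) xor ((b ∧ y) xor Y)
  distrib = solve 5 (λ b x y X Y → (b :* (x :+ y)) :+ (X :+ Y) := ((b :* x) :+ X) :+ ((b :* y) :+ Y)) refl

oddCount-⊥ : ∀ {n} (p : Fin n → Bool) → oddCount ⊥ p ≡ false
oddCount-⊥ {zero}  p = refl
oddCount-⊥ {suc n} p = oddCount-⊥ (p ∘ suc)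

oddCount-⁅⁆ : ∀ {n} (u : Fin n) (p : Fin n → Bool) → oddCount ⁅ u ⁆ p ≡ p u
oddCount-⁅⁆ zero    p = ≡.trans (cong (p zero xor_) (oddCount-⊥ (p ∘ suc))) (xor-identityʳ (p zero))
oddCount-⁅⁆ (suc u) p = oddCount-⁅⁆ u (p ∘ suc)

oddCount-∪ : ∀ {n} (V B : Subset n) → V ∩ B ≡ ⊥ → (p : Fin n → Bool) →
             oddCount (V ∪ B) p ≡ oddCount V p xor oddCount B p
oddCount-∪ []            []      _  p = refl
oddCount-∪ (inside ∷ V)  (b ∷ B) eq p with Vecₚ.∷-injective eq
... | refl , eq′ = ≡.trans (cong (p zero xor_) (oddCount-∪ V B eq′ (p ∘ suc)))
                           (≡.sym (xor-assoc (p zero) (oddCount V (p ∘ suc)) (oddCount B (p ∘ suc))))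
oddCount-∪ (outside ∷ V) (b ∷ B) eq p =
  ≡.trans (cong ((b ∧ p zero) xor_) (oddCount-∪ V B (proj₂ (Vecₚ.∷-injective eq)) (p ∘ suc)))
          (rotate (b ∧ p zero) (oddCount V (p ∘ suc)) (oddCount B (p ∘ suc)))
  where
  open XorSolver
  rotate : ∀ x X Y → x xor (X xor Y) ≡ X xor (x xor Y)
  rotate = solve 3 (λ x X Y → x :+ (X :+ Y) := X :+ (x :+ Y)) refl

oddCount-insert : ∀ {n} (V : Subset n) {u} → u ∉ V → (p : Fin n → Bool) →
                  oddCount (V ∪ ⁅ u ⁆) p ≡ oddCount V p xor p u
oddCount-insert V {u} u∉V p =
  ≡.trans (oddCount-∪ V ⁅ u ⁆ (x∉p⇒p∩⁅x⁆≡⊥ u∉V) p) (cong (oddCount V p xor_) (oddCount-⁅⁆ u p))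

indicator : Bool → ℕ
indicator b = if b then 1 else 0

parity-indicator : ∀ b → parity (indicator b) ≡ b
parity-indicator true  = refl
parity-indicator false = refl

countL≡sum-indicator : ∀ {a} {A : Set a} (p : A → Bool) (xs : List A) →
                       countL p xs ≡ sum (map (indicator ∘ p) xs)
countL≡sum-indicator p []       = refl
countL≡sum-indicator p (x ∷ xs) with p x
... | true  = cong suc (countL≡sum-indicator p xs)
... | false = countL≡sum-indicator p xs

parity-sum-elements : ∀ {n} (S : Subset n) (g : Fin n → ℕ) →
                      parity (sum (map g (elements S))) ≡ oddCount S (parity ∘ g)
parity-sum-elements []      g = refl
parity-sum-elements (b ∷ S) g =
  ≡.trans (cong (parity ∘ sum ∘ map g) (elements-∷ b S)) (head-case b)
  where
  tail-sum : parity (sum (map g (map suc (elements S)))) ≡ oddCount S (parity ∘ g ∘ suc)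
  tail-sum = ≡.trans (cong (parity ∘ sum) (≡.sym (map-∘ (elements S)))) (parity-sum-elements S (g ∘ suc))
  head-case : ∀ b → parity (sum (map g (if b then zero ∷ map suc (elements S) else map suc (elements S))))
                    ≡ (b ∧ parity (g zero)) xor oddCount S (parity ∘ g ∘ suc)
  head-case true  = ≡.trans (parity-+ (g zero) _) (cong (parity (g zero) xor_) tail-sum)
  head-case false = tail-sum

parity-countL-elements : ∀ {n} (S : Subset n) (p : Fin n → Bool) →
                         parity (countL p (elements S)) ≡ oddCount S p
parity-countL-elements S p =
  ≡.trans (cong parity (countL≡sum-indicator p (elements S)))
          (≡.trans (parity-sum-elements S (indicator ∘ p)) (oddCount-cong S (λ {x} _ → parity-indicator (p x))))

_<ᵇ_ : ∀ {n} → Fin n → Fin n → Bool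
i <ᵇ j = does (i Fin.<? j)

does<?-flip : ∀ {m n} → m ≢ n → does (n ℕ.<? m) ≡ not (does (m ℕ.<? n))
does<?-flip {m} {n} m≢n with ℕₚ.<-cmp m n
... | tri< m<n _ n≮m = ≡.trans (dec-false (n ℕ.<? m) n≮m) (cong not (≡.sym (dec-true (m ℕ.<? n) m<n)))
... | tri≈ _ m≡n _   = ⊥-elim (m≢n m≡n)
... | tri> m≮n _ n<m = ≡.trans (dec-true (n ℕ.<? m) n<m) (cong not (≡.sym (dec-false (m ℕ.<? n) m≮n)))

<ᵇ-flip : ∀ {n} {x y : Fin n} → x ≢ y → y <ᵇ x ≡ not (x <ᵇ y)
<ᵇ-flip x≢y = does<?-flip (x≢y ∘ Finₚ.toℕ-injective)

<ᵇ-irrefl : ∀ {n} (x : Fin n) → x <ᵇ x ≡ false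
<ᵇ-irrefl x = dec-false (x Fin.<? x) (Finₚ.<-irrefl refl)

below : ∀ {n} → Subset n → Fin n → Bool
below S i = oddCount S (_<ᵇ i)

inversionParity : ∀ {n} → Subset n → Subset n → Bool
inversionParity S T = oddCount S (below T)

parity-inversions : ∀ {n} (S T : Subset n) →
                    parity (sum (map (λ s → countL (_<ᵇ s) (elements T)) (elements S))) ≡ inversionParity S T
parity-inversions S T =
  ≡.trans (parity-sum-elements S _) (oddCount-cong S (λ {s} _ → parity-countL-elements T (_<ᵇ s)))

-- for c, u ∉ V, the parity of the number of elements of V strictly between c and u
between : ∀ {n} → Subset n → Fin n → Fin n → Bool
between V c u = below V u xor below V c

inversionParity-insertˡ : ∀ {n} (V B : Subset n) {u} → u ∉ V →
                          inversionParity (V ∪ ⁅ u ⁆) B ≡ inversionParity V B xor below B u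
inversionParity-insertˡ V B u∉V = oddCount-insert V u∉V (below B)

inversionParity-insertʳ : ∀ {n} (A V : Subset n) {u} → u ∉ V →
                          inversionParity A (V ∪ ⁅ u ⁆) ≡ inversionParity A V xor oddCount A (u <ᵇ_)
inversionParity-insertʳ A V {u} u∉V =
  ≡.trans (oddCount-cong A (λ {a} _ → oddCount-insert V u∉V (_<ᵇ a))) (oddCount-xor A (below V) (u <ᵇ_))

between-∪ : ∀ {n} (V B : Subset n) → V ∩ B ≡ ⊥ → ∀ c u → between (V ∪ B) c u ≡ between V c u xor between B c u
between-∪ V B disjoint c u =
  ≡.trans (cong₂ _xor_ (oddCount-∪ V B disjoint (_<ᵇ u)) (oddCount-∪ V B disjoint (_<ᵇ c)))
          (interchange (below V u) (below B u) (below V c) (below B c))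
  where
  open XorSolver
  interchange : ∀ a b x y → (a xor b) xor (x xor y) ≡ (a xor x) xor (b xor y)
  interchange = solve 4 (λ a b x y → (a :+ b) :+ (x :+ y) := (a :+ x) :+ (b :+ y)) refl

between-above : ∀ {n} (A : Subset n) {c u} → c ∉ A → u ∉ A → between A c u ≡ oddCount A (u <ᵇ_) xor oddCount A (c <ᵇ_)
between-above A {c} {u} c∉A u∉A =
  ≡.trans (≡.sym (oddCount-xor A (_<ᵇ u) (_<ᵇ c)))
          (≡.trans (oddCount-cong A flip) (oddCount-xor A (u <ᵇ_) (c <ᵇ_)))
  where
  flip : ∀ {a} → a ∈ A → (a <ᵇ u) xor (a <ᵇ c) ≡ (u <ᵇ a) xor (c <ᵇ a)
  flip {a} a∈A = ≡.trans (≡.sym (xor-annihilates-not (a <ᵇ u) (a <ᵇ c)))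
                         (≡.sym (cong₂ _xor_ (<ᵇ-flip {x = a} {u} (λ { refl → u∉A a∈A }))
                                             (<ᵇ-flip {x = a} {c} (λ { refl → c∉A a∈A }))))

below-swapped-pair : ∀ {n} (V : Subset n) {c u} → c ≢ u → c ∉ V → u ∉ V →
                     below ((V ∪ ⁅ u ⁆) ∪ ⁅ c ⁆) c xor between V c u ≡ not (below ((V ∪ ⁅ u ⁆) ∪ ⁅ c ⁆) u)
below-swapped-pair V {c} {u} c≢u c∉V u∉V = begin
  below C c xor between V c u
    ≡⟨ cong (_xor between V c u)
            (≡.trans (below-C c) (cong₂ (λ x y → (below V c xor x) xor y) (<ᵇ-flip c≢u) (<ᵇ-irrefl c))) ⟩
  ((below V c xor not (c <ᵇ u)) xor false) xor between V c u
    ≡⟨ identity (below V c) (below V u) (c <ᵇ u) ⟩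
  not ((below V u xor false) xor (c <ᵇ u))
    ≡⟨ cong not (≡.sym (≡.trans (below-C u) (cong (λ x → (below V u xor x) xor (c <ᵇ u)) (<ᵇ-irrefl u)))) ⟩
  not (below C u) ∎
  where
  open ≡-Reasoning
  open XorSolver
  C : Subset _
  C = (V ∪ ⁅ u ⁆) ∪ ⁅ c ⁆
  c∉V∪u : c ∉ V ∪ ⁅ u ⁆
  c∉V∪u c∈ with x∈p∪⁅y⁆⁻ V c∈
  ... | inj₁ c∈V = c∉V c∈V
  ... | inj₂ c≡u = c≢u c≡u
  below-C : ∀ i → below C i ≡ (below V i xor (u <ᵇ i)) xor (c <ᵇ i)
  below-C i = ≡.trans (oddCount-insert (V ∪ ⁅ u ⁆) c∉V∪u (_<ᵇ i)) (cong (_xor (c <ᵇ i)) (oddCount-insert V u∉V (_<ᵇ i)))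
  identity : ∀ vc vu cu → ((vc xor not cu) xor false) xor (vu xor vc) ≡ not ((vu xor false) xor cu)
  identity = solve 3 (λ vc vu cu → ((vc :+ (con true :+ cu)) :+ con false) :+ (vu :+ vc)
                                  := con true :+ ((vu :+ con false) :+ cu)) refl

module ListSum {c ℓ} (R : CommutativeRing c ℓ) where
  open CommutativeRing R renaming (refl to ≈-refl) hiding (zero; _-_)
  open import Relation.Binary.Reasoning.Setoid setoid
  import Algebra.Properties.CommutativeSemigroup +-commutativeSemigroup as +-CS

  private
    variable
      a b : Level
      A : Set a
      B : Set b

  ∑ : List A → (A → Carrier) → Carrier
  ∑ []       f = 0#
  ∑ (x ∷ xs) f = f x + ∑ xs f

  infix 5 ∑
  syntax ∑ xs (λ x → f) = ∑[ x ← xs ] f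

  ∑-cong : ∀ (xs : List A) {f g : A → Carrier} → (∀ x → f x ≈ g x) → ∑ xs f ≈ ∑ xs g
  ∑-cong []       eq = ≈-refl
  ∑-cong (x ∷ xs) eq = +-cong (eq x) (∑-cong xs eq)

  ∑-zero : ∀ (xs : List A) {f : A → Carrier} → (∀ x → f x ≈ 0#) → ∑ xs f ≈ 0#
  ∑-zero []       eq = ≈-refl
  ∑-zero (x ∷ xs) eq = trans (+-cong (eq x) (∑-zero xs eq)) (+-identityˡ 0#)

  ∑-distrib-+ : ∀ (xs : List A) (f g : A → Carrier) → ∑[ x ← xs ] (f x + g x) ≈ ∑ xs f + ∑ xs g
  ∑-distrib-+ []       f g = sym (+-identityˡ 0#)
  ∑-distrib-+ (x ∷ xs) f g =
    trans (+-congˡ (∑-distrib-+ xs f g)) (+-CS.interchange (f x) (g x) (∑ xs f) (∑ xs g))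

  *-distribˡ-∑ : ∀ (k : Carrier) (xs : List A) (f : A → Carrier) → k * ∑ xs f ≈ ∑[ x ← xs ] (k * f x)
  *-distribˡ-∑ k []       f = zeroʳ k
  *-distribˡ-∑ k (x ∷ xs) f = trans (distribˡ k (f x) (∑ xs f)) (+-congˡ (*-distribˡ-∑ k xs f))

  *-distribʳ-∑ : ∀ (k : Carrier) (xs : List A) (f : A → Carrier) → ∑ xs f * k ≈ ∑[ x ← xs ] (f x * k)
  *-distribʳ-∑ k xs f =
    trans (*-comm (∑ xs f) k) (trans (*-distribˡ-∑ k xs f) (∑-cong xs (λ x → *-comm k (f x))))

  ∑-comm : ∀ (xs : List A) (ys : List B) (f : A → B → Carrier) →
           ∑[ x ← xs ] ∑[ y ← ys ] f x y ≈ ∑[ y ← ys ] ∑[ x ← xs ] f x y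
  ∑-comm []       ys f = sym (∑-zero ys (λ _ → ≈-refl))
  ∑-comm (x ∷ xs) ys f =
    trans (+-congˡ (∑-comm xs ys f)) (sym (∑-distrib-+ ys (f x) (λ y → ∑[ x ← xs ] f x y)))

  ∑-++ : ∀ (xs ys : List A) (f : A → Carrier) → ∑ (xs ++ ys) f ≈ ∑ xs f + ∑ ys f
  ∑-++ []       ys f = sym (+-identityˡ _)
  ∑-++ (x ∷ xs) ys f = trans (+-congˡ (∑-++ xs ys f)) (sym (+-assoc _ _ _))

  ∑-map : ∀ (g : B → A) (xs : List B) (f : A → Carrier) → ∑ (map g xs) f ≡ ∑ xs (f ∘ g)
  ∑-map g []       f = refl
  ∑-map g (x ∷ xs) f = cong (f (g x) +_) (∑-map g xs f)

  ∑-filter : ∀ {p} {P : A → Set p} (P? : ∀ x → Dec (P x)) (xs : List A) (f : A → Carrier) →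
             ∑ (filter P? xs) f ≈ ∑[ x ← xs ] (if does (P? x) then f x else 0#)
  ∑-filter P? []       f = ≈-refl
  ∑-filter P? (x ∷ xs) f with does (P? x)
  ... | true  = +-congˡ (∑-filter P? xs f)
  ... | false = trans (∑-filter P? xs f) (sym (+-identityˡ _))

  ∑-allFin-suc : ∀ {m} (g : Fin (suc m) → Carrier) → ∑ (allFin (suc m)) g ≡ g zero + ∑ (allFin m) (g ∘ suc)
  ∑-allFin-suc {m} g =
    cong (g zero +_) (≡.trans (cong (λ xs → ∑ xs g) (≡.sym (map-tabulate (λ i → i) suc))) (∑-map suc (allFin m) g))

  ∑-allFin-one : ∀ {m} (g : Fin m → Carrier) (x : Fin m) → (∀ z → z ≢ x → g z ≈ 0#) → ∑ (allFin m) g ≈ g x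
  ∑-allFin-one {suc m} g zero    vanish = begin
    ∑ (allFin (suc m)) g                    ≡⟨ ∑-allFin-suc g ⟩
    g zero + ∑ (allFin m) (g ∘ suc)         ≈⟨ +-congˡ (∑-zero (allFin m) (λ z → vanish (suc z) (λ ()))) ⟩
    g zero + 0#                             ≈⟨ +-identityʳ _ ⟩
    g zero                                  ∎
  ∑-allFin-one {suc m} g (suc x) vanish = begin
    ∑ (allFin (suc m)) g                    ≡⟨ ∑-allFin-suc g ⟩
    g zero + ∑ (allFin m) (g ∘ suc)         ≈⟨ +-cong (vanish zero (λ ()))
                                                      (∑-allFin-one (g ∘ suc) x (λ z z≢x → vanish (suc z) (z≢x ∘ Finₚ.suc-injective))) ⟩
    0# + g (suc x)                          ≈⟨ +-identityˡ _ ⟩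
    g (suc x)                               ∎

  ∑-allFin-two : ∀ {m} (g : Fin m → Carrier) {x y : Fin m} → x ≢ y →
                 (∀ z → z ≢ x → z ≢ y → g z ≈ 0#) → ∑ (allFin m) g ≈ g x + g y
  ∑-allFin-two {suc m} g {zero}  {zero}  x≢y vanish = ⊥-elim (x≢y refl)
  ∑-allFin-two {suc m} g {zero}  {suc y} x≢y vanish =
    trans (reflexive (∑-allFin-suc g))
          (+-congˡ (∑-allFin-one (g ∘ suc) y (λ z z≢y → vanish (suc z) (λ ()) (z≢y ∘ Finₚ.suc-injective))))
  ∑-allFin-two {suc m} g {suc x} {zero}  x≢y vanish =
    trans (∑-allFin-two g {zero} {suc x} (λ ()) (λ z z≢0 z≢x → vanish z z≢x z≢0)) (+-comm _ _)
  ∑-allFin-two {suc m} g {suc x} {suc y} x≢y vanish = begin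
    ∑ (allFin (suc m)) g                    ≡⟨ ∑-allFin-suc g ⟩
    g zero + ∑ (allFin m) (g ∘ suc)         ≈⟨ +-cong (vanish zero (λ ()) (λ ()))
                                                      (∑-allFin-two (g ∘ suc) (x≢y ∘ cong suc)
                                                         (λ z z≢x z≢y → vanish (suc z) (z≢x ∘ Finₚ.suc-injective) (z≢y ∘ Finₚ.suc-injective))) ⟩
    0# + (g (suc x) + g (suc y))            ≈⟨ +-identityˡ _ ⟩
    g (suc x) + g (suc y)                   ∎

  module _ {m} (C : Subset m) (f : Fin m → Carrier) where

    private
      g : Fin m → Carrier
      g i = if does (i ∈? C) then f i else 0#

      g-on : ∀ {i} → i ∈ C → g i ≈ f i
      g-on {i} i∈C with i ∈? C
      ... | yes _  = ≈-refl
      ... | no i∉C = ⊥-elim (i∉C i∈C)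

    ∑-elements-zero : (∀ {i} → i ∈ C → f i ≈ 0#) → ∑ (elements C) f ≈ 0#
    ∑-elements-zero vanish = trans (∑-filter (_∈? C) (allFin m) f) (∑-zero (allFin m) λ i → case-∈ i)
      where
      case-∈ : ∀ i → g i ≈ 0#
      case-∈ i with i ∈? C
      ... | yes i∈C = vanish i∈C
      ... | no  _   = ≈-refl

    ∑-elements-two : ∀ {c u} → c ≢ u → c ∈ C → u ∈ C → (∀ {i} → i ∈ C → i ≢ c → i ≢ u → f i ≈ 0#) →
                     ∑ (elements C) f ≈ f c + f u
    ∑-elements-two {c} {u} c≢u c∈C u∈C vanish =
      trans (∑-filter (_∈? C) (allFin m) f)
            (trans (∑-allFin-two g c≢u case-∈) (+-cong (g-on c∈C) (g-on u∈C)))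
      where
      case-∈ : ∀ i → i ≢ c → i ≢ u → g i ≈ 0#
      case-∈ i i≢c i≢u with i ∈? C
      ... | yes i∈C = vanish i∈C i≢c i≢u
      ... | no  _   = ≈-refl

  ∑-allSubsets-∷ : ∀ {m} (h : Subset (suc m) → Carrier) →
                   ∑ (allSubsets (suc m)) h ≈ ∑ (allSubsets m) (h ∘ (inside ∷_)) + ∑ (allSubsets m) (h ∘ (outside ∷_))
  ∑-allSubsets-∷ {m} h =
    trans (∑-++ (map (inside ∷_) (allSubsets m)) (map (outside ∷_) (allSubsets m)) h)
          (reflexive (cong₂ _+_ (∑-map (inside ∷_) (allSubsets m) h) (∑-map (outside ∷_) (allSubsets m) h)))

  ∑-allSubsets-one : ∀ {m} (h : Subset m → Carrier) (S : Subset m) → (∀ V → V ≢ S → h V ≈ 0#) →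
                     ∑ (allSubsets m) h ≈ h S
  ∑-allSubsets-one h []            vanish = +-identityʳ _
  ∑-allSubsets-one h (inside ∷ S)  vanish = begin
    ∑ (allSubsets _) h                                                  ≈⟨ ∑-allSubsets-∷ h ⟩
    ∑ (allSubsets _) (h ∘ (inside ∷_)) + ∑ (allSubsets _) (h ∘ (outside ∷_))
      ≈⟨ +-cong (∑-allSubsets-one (h ∘ (inside ∷_)) S (λ V V≢S → vanish (inside ∷ V) (V≢S ∘ cong Vec.tail)))
                (∑-zero (allSubsets _) (λ V → vanish (outside ∷ V) (λ ()))) ⟩
    h (inside ∷ S) + 0#                                                 ≈⟨ +-identityʳ _ ⟩
    h (inside ∷ S)                                                      ∎
  ∑-allSubsets-one h (outside ∷ S) vanish = begin
    ∑ (allSubsets _) h                                                  ≈⟨ ∑-allSubsets-∷ h ⟩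
    ∑ (allSubsets _) (h ∘ (inside ∷_)) + ∑ (allSubsets _) (h ∘ (outside ∷_))
      ≈⟨ +-cong (∑-zero (allSubsets _) (λ V → vanish (inside ∷ V) (λ ())))
                (∑-allSubsets-one (h ∘ (outside ∷_)) S (λ V V≢S → vanish (outside ∷ V) (V≢S ∘ cong Vec.tail))) ⟩
    0# + h (outside ∷ S)                                                ≈⟨ +-identityˡ _ ⟩
    h (outside ∷ S)                                                     ∎

module Signs {c ℓ} (R : CommutativeRing c ℓ) where
  open CommutativeRing R renaming (refl to ≈-refl) hiding (zero; _-_)
  open import Algebra.Properties.Ring ring using (-1*x≈-x; -‿involutive)

  sign : Bool → Carrier
  sign true  = - 1#
  sign false = 1#

  sign-xor : ∀ a b → sign (a xor b) ≈ sign a * sign b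
  sign-xor true  true  = sym (trans (-1*x≈-x (- 1#)) (-‿involutive 1#))
  sign-xor true  false = sym (*-identityʳ _)
  sign-xor false b     = sym (*-identityˡ _)

  sign-not : ∀ b → sign (not b) ≈ - sign b
  sign-not true  = sym (-‿involutive 1#)
  sign-not false = ≈-refl

  sign*sign≈1 : ∀ b → sign b * sign b ≈ 1#
  sign*sign≈1 b = trans (sym (sign-xor b b)) (reflexive (cong sign (xor-same b)))

  sign-transfer : ∀ i b j d {x y} → i xor b ≡ d xor j → y ≈ sign b * x → sign i * y ≈ sign d * (sign j * x)
  sign-transfer i b j d {x} {y} parities y≈ = begin
    sign i * y                ≈⟨ *-congˡ y≈ ⟩
    sign i * (sign b * x)     ≈⟨ *-assoc _ _ _ ⟨
    (sign i * sign b) * x     ≈⟨ *-congʳ (sign-xor i b) ⟨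
    sign (i xor b) * x        ≡⟨ cong (λ p → sign p * x) parities ⟩
    sign (d xor j) * x        ≈⟨ *-congʳ (sign-xor d j) ⟩
    (sign d * sign j) * x     ≈⟨ *-assoc _ _ _ ⟩
    sign d * (sign j * x)     ∎
    where open import Relation.Binary.Reasoning.Setoid setoid

module Pairing {c ℓ} (R : CommutativeRing c ℓ) (n : ℕ) where
  open CommutativeRing R renaming (refl to ≈-refl) hiding (zero; _-_)
  open import Algebra.Properties.CommutativeSemigroup *-commutativeSemigroup using (x∙yz≈y∙xz)
  open import Relation.Binary.Reasoning.Setoid setoid
  open ListSum R
  open Signs R
  open Exterior R n renaming (_∧_ to _∧ᴱ_)

  sgn≈sign∘parity : ∀ k → sgn k ≈ sign (parity k)
  sgn≈sign∘parity zero    = ≈-refl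
  sgn≈sign∘parity (suc k) = trans (-‿cong (sgn≈sign∘parity k)) (sym (sign-not (parity k)))

  sgn-inversions : ∀ S T → sgn (inversions S T) ≈ sign (inversionParity S T)
  sgn-inversions S T = trans (sgn≈sign∘parity (inversions S T)) (reflexive (cong sign (parity-inversions S T)))

  sgn-position : ∀ S i → sgn (countL (_<ᵇ i) (elems S)) ≈ sign (below S i)
  sgn-position S i = trans (sgn≈sign∘parity (countL (_<ᵇ i) (elems S)))
                           (reflexive (cong sign (parity-countL-elements S (_<ᵇ i))))

  Functional : Set c
  Functional = Subset n → Carrier

  ⟨_∣_⟩ : Functional → Elt → Carrier
  ⟨ κ ∣ x ⟩ = ∑[ V ← allSubsets n ] x V * κ V

  ⟨∣⟩-cong : ∀ κ {x y} → x ≈E y → ⟨ κ ∣ x ⟩ ≈ ⟨ κ ∣ y ⟩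
  ⟨∣⟩-cong κ x≈y = ∑-cong (allSubsets n) (λ V → *-congʳ (x≈y V))

  ⟨∣e⟩ : ∀ κ S → ⟨ κ ∣ e S ⟩ ≈ κ S
  ⟨∣e⟩ κ S = trans (∑-allSubsets-one (λ V → e S V * κ V) S off) on
    where
    off : ∀ V → V ≢ S → e S V * κ V ≈ 0#
    off V V≢S with V ≟S S
    ... | yes V≡S = ⊥-elim (V≢S V≡S)
    ... | no  _   = zeroˡ (κ V)
    on : e S S * κ S ≈ κ S
    on with S ≟S S
    ... | yes _   = *-identityˡ (κ S)
    ... | no  S≢S = ⊥-elim (S≢S refl)

  ⟨∣•⟩ : ∀ κ a x → ⟨ κ ∣ a • x ⟩ ≈ a * ⟨ κ ∣ x ⟩
  ⟨∣•⟩ κ a x = trans (∑-cong (allSubsets n) (λ V → *-assoc a (x V) (κ V))) (sym (*-distribˡ-∑ a (allSubsets n) _))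

  ⟨∣zeroE⟩ : ∀ κ → ⟨ κ ∣ zeroE ⟩ ≈ 0#
  ⟨∣zeroE⟩ κ = ∑-zero (allSubsets n) (λ V → zeroˡ (κ V))

  sumE-apply : ∀ {a} {A : Set a} (F : A → Elt) (xs : List A) V → sumE (map F xs) V ≡ ∑[ i ← xs ] F i V
  sumE-apply F []       V = refl
  sumE-apply F (x ∷ xs) V = cong (F x V +_) (sumE-apply F xs V)

  ⟨∣sumE⟩ : ∀ {a} {A : Set a} κ (F : A → Elt) (xs : List A) → ⟨ κ ∣ sumE (map F xs) ⟩ ≈ ∑[ i ← xs ] ⟨ κ ∣ F i ⟩
  ⟨∣sumE⟩ κ F xs = begin
    ∑[ V ← allSubsets n ] sumE (map F xs) V * κ V      ≈⟨ ∑-cong (allSubsets n) expand ⟩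
    ∑[ V ← allSubsets n ] ∑[ i ← xs ] F i V * κ V      ≈⟨ ∑-comm (allSubsets n) xs (λ V i → F i V * κ V) ⟩
    ∑[ i ← xs ] ⟨ κ ∣ F i ⟩                             ∎
    where
    expand : ∀ V → sumE (map F xs) V * κ V ≈ ∑[ i ← xs ] F i V * κ V
    expand V = trans (*-congʳ (reflexive (sumE-apply F xs V))) (*-distribʳ-∑ (κ V) xs (λ i → F i V))

  ⟨∣linComb⟩ : ∀ κ coef → ⟨ κ ∣ linComb coef ⟩ ≈ ∑[ S ← allSubsets n ] coef S * κ S
  ⟨∣linComb⟩ κ coef = trans (⟨∣sumE⟩ κ _ (allSubsets n))
                            (∑-cong (allSubsets n) (λ S → trans (⟨∣•⟩ κ (coef S) (e S)) (*-congˡ (⟨∣e⟩ κ S))))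

  ⟨∣∂e⟩ : ∀ κ S → ⟨ κ ∣ ∂e S ⟩ ≈ ∑[ i ← elements S ] sign (below S i) * κ (S - i)
  ⟨∣∂e⟩ κ S = trans (⟨∣sumE⟩ κ _ (elements S))
                    (∑-cong (elements S) (λ i → trans (⟨∣•⟩ κ _ (e (S - i))) (*-cong (sgn-position S i) (⟨∣e⟩ κ (S - i)))))

  ⟨_∣_⋀_⟩ : Functional → Subset n → Subset n → Carrier
  ⟨ κ ∣ S ⋀ T ⟩ with (S ∩ T) ≟S ⊥
  ... | yes _ = sign (inversionParity S T) * κ (S ∪ T)
  ... | no  _ = 0#

  ⟨∣mulBasis⟩ : ∀ κ S T → ⟨ κ ∣ mulBasis S T ⟩ ≈ ⟨ κ ∣ S ⋀ T ⟩
  ⟨∣mulBasis⟩ κ S T with (S ∩ T) ≟S ⊥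
  ... | yes _ = trans (⟨∣•⟩ κ _ (e (S ∪ T))) (*-cong (sgn-inversions S T) (⟨∣e⟩ κ (S ∪ T)))
  ... | no  _ = ⟨∣zeroE⟩ κ

  ⋀-disjoint : ∀ κ A B → A ∩ B ≡ ⊥ → ⟨ κ ∣ A ⋀ B ⟩ ≈ sign (inversionParity A B) * κ (A ∪ B)
  ⋀-disjoint κ A B disjoint with (A ∩ B) ≟S ⊥
  ... | yes _    = ≈-refl
  ... | no meets = ⊥-elim (meets disjoint)

  ⋀-meets : ∀ κ A B {x} → x ∈ A → x ∈ B → ⟨ κ ∣ A ⋀ B ⟩ ≈ 0#
  ⋀-meets κ A B x∈A x∈B with (A ∩ B) ≟S ⊥
  ... | yes disjoint = ⊥-elim (p∩q≡⊥⇒x∉q disjoint x∈A x∈B)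
  ... | no  _        = ≈-refl

  ⋀-vanishes : ∀ κ A B → (A ∩ B ≡ ⊥ → κ (A ∪ B) ≈ 0#) → ⟨ κ ∣ A ⋀ B ⟩ ≈ 0#
  ⋀-vanishes κ A B vanish with (A ∩ B) ≟S ⊥
  ... | yes disjoint = trans (*-congˡ (vanish disjoint)) (zeroʳ _)
  ... | no  _        = ≈-refl

  -- κ ▷ z is the functional x ↦ κ (x ∧ z), and κ ◁ x is z ↦ κ (x ∧ z)
  infixl 6 _▷_ _◁_
  _▷_ : Functional → Elt → Functional
  (κ ▷ z) S = ∑[ T ← allSubsets n ] z T * ⟨ κ ∣ S ⋀ T ⟩

  _◁_ : Functional → Elt → Functional
  (κ ◁ x) T = ∑[ S ← allSubsets n ] x S * ⟨ κ ∣ S ⋀ T ⟩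

  ⟨∣∧⟩ : ∀ κ x z → ⟨ κ ∣ x ∧ᴱ z ⟩ ≈ ∑[ S ← allSubsets n ] ∑[ T ← allSubsets n ] (x S * z T) * ⟨ κ ∣ S ⋀ T ⟩
  ⟨∣∧⟩ κ x z = begin
    ⟨ κ ∣ x ∧ᴱ z ⟩
      ≈⟨ ⟨∣sumE⟩ κ _ (allSubsets n) ⟩
    ∑[ S ← allSubsets n ] ⟨ κ ∣ sumE (map (λ T → (x S * z T) • mulBasis S T) (allSubsets n)) ⟩
      ≈⟨ ∑-cong (allSubsets n) (λ S → ⟨∣sumE⟩ κ _ (allSubsets n)) ⟩
    ∑[ S ← allSubsets n ] ∑[ T ← allSubsets n ] ⟨ κ ∣ (x S * z T) • mulBasis S T ⟩
      ≈⟨ ∑-cong (allSubsets n) (λ S → ∑-cong (allSubsets n) (λ T →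
           trans (⟨∣•⟩ κ _ _) (*-congˡ (⟨∣mulBasis⟩ κ S T)))) ⟩
    ∑[ S ← allSubsets n ] ∑[ T ← allSubsets n ] (x S * z T) * ⟨ κ ∣ S ⋀ T ⟩
      ∎

  ⟨∣∧⟩≈⟨▷∣⟩ : ∀ κ x z → ⟨ κ ∣ x ∧ᴱ z ⟩ ≈ ⟨ κ ▷ z ∣ x ⟩
  ⟨∣∧⟩≈⟨▷∣⟩ κ x z = trans (⟨∣∧⟩ κ x z) (∑-cong (allSubsets n) (λ S →
    trans (∑-cong (allSubsets n) (λ T → *-assoc (x S) (z T) _)) (sym (*-distribˡ-∑ (x S) (allSubsets n) _))))

  ⟨∣∧⟩≈⟨◁∣⟩ : ∀ κ x z → ⟨ κ ∣ x ∧ᴱ z ⟩ ≈ ⟨ κ ◁ x ∣ z ⟩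
  ⟨∣∧⟩≈⟨◁∣⟩ κ x z = trans (⟨∣∧⟩ κ x z) (trans (∑-comm (allSubsets n) (allSubsets n) _) (∑-cong (allSubsets n) (λ T →
    trans (∑-cong (allSubsets n) (λ S → trans (*-congʳ (*-comm (x S) (z T))) (*-assoc (z T) (x S) _)))
          (sym (*-distribˡ-∑ (z T) (allSubsets n) _)))))

  ▷-vanishes : ∀ κ b W → (∀ T → ⟨ κ ∣ W ⋀ T ⟩ ≈ 0#) → (κ ▷ b) W ≈ 0#
  ▷-vanishes κ b W vanish = ∑-zero (allSubsets n) (λ T → trans (*-congˡ (vanish T)) (zeroʳ _))

  ◁-vanishes : ∀ κ a W → (∀ T → ⟨ κ ∣ T ⋀ W ⟩ ≈ 0#) → (κ ◁ a) W ≈ 0#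
  ◁-vanishes κ a W vanish = ∑-zero (allSubsets n) (λ T → trans (*-congˡ (vanish T)) (zeroʳ _))

  ▷-scales : ∀ κ b P Q k → (∀ T → ⟨ κ ∣ P ⋀ T ⟩ ≈ k * ⟨ κ ∣ Q ⋀ T ⟩) → (κ ▷ b) P ≈ k * (κ ▷ b) Q
  ▷-scales κ b P Q k scaled = trans (∑-cong (allSubsets n) (λ T → trans (*-congˡ (scaled T)) (x∙yz≈y∙xz (b T) k _)))
                                (sym (*-distribˡ-∑ k (allSubsets n) _))

  ◁-scales : ∀ κ a P Q k → (∀ T → ⟨ κ ∣ T ⋀ P ⟩ ≈ k * ⟨ κ ∣ T ⋀ Q ⟩) → (κ ◁ a) P ≈ k * (κ ◁ a) Q
  ◁-scales κ a P Q k scaled = trans (∑-cong (allSubsets n) (λ T → trans (*-congˡ (scaled T)) (x∙yz≈y∙xz (a T) k _)))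
                                (sym (*-distribˡ-∑ k (allSubsets n) _))

  ⟨∣sumE⟩-vanishing : ∀ {a q} {A : Set a} {Q : A → Set q} κ (F : A → Elt) {xs : List A} → All Q xs →
                      (∀ {x} → Q x → ⟨ κ ∣ F x ⟩ ≈ 0#) → ⟨ κ ∣ sumE (map F xs) ⟩ ≈ 0#
  ⟨∣sumE⟩-vanishing {Q = Q} κ F {xs} all vanish = trans (⟨∣sumE⟩ κ F xs) (go all)
    where
    go : ∀ {xs} → All Q xs → ∑[ x ← xs ] ⟨ κ ∣ F x ⟩ ≈ 0#
    go []         = ≈-refl
    go (qx ∷ qxs) = trans (+-cong (vanish qx) (go qxs)) (+-identityˡ 0#)

-- Closures and levels for an r-nbb set

module Decide {n} (G : Matroid n) (r : ℕ) where
  open Matroid G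

  inClosure? : ∀ X i → Dec (InClosure G X i)
  inClosure? X i = rk (X ∪ ⁅ i ⁆) ℕ.≟ rk X

  rClosed? : ∀ X → Dec (RClosed G r X)
  rClosed? X = ∀-subset? (λ T → (T ⊆? X) →-dec (∣ T ∣ ℕ.≤? r) →-dec Finₚ.all? (λ i → inClosure? T i →-dec (i ∈? X)))

  inRClosure? : ∀ U i → Dec (InRClosure G r U i)
  inRClosure? U i = ∀-subset? (λ X → rClosed? X →-dec (U ⊆? X) →-dec (i ∈? X))

  nbb? : ∀ S → Dec (NBB G r S)
  nbb? S = Finₚ.all? (λ i → (i ∈? S) →-dec Finₚ.all? (λ j → inRClosure? (upperPart G S i) j →-dec (i Fin.≤? j)))

module RankProperties {n} (G : Matroid n) where
  open Matroid G

  rk-⊥ : rk ⊥ ≡ 0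
  rk-⊥ = ℕₚ.n≤0⇒n≡0 (subst (rk ⊥ ℕ.≤_) (∣⊥∣≡0 n) (rk-bound ⊥))

  rk-∪⁅⁆≤ : ∀ X x → rk (X ∪ ⁅ x ⁆) ℕ.≤ suc (rk X)
  rk-∪⁅⁆≤ X x = begin
    rk (X ∪ ⁅ x ⁆)                       ≤⟨ ℕₚ.m≤m+n _ _ ⟩
    rk (X ∪ ⁅ x ⁆) ℕ.+ rk (X ∩ ⁅ x ⁆)    ≤⟨ rk-submod X ⁅ x ⁆ ⟩
    rk X ℕ.+ rk ⁅ x ⁆                    ≤⟨ ℕₚ.+-monoʳ-≤ (rk X) (subst (rk ⁅ x ⁆ ℕ.≤_) (∣⁅x⁆∣≡1 x) (rk-bound ⁅ x ⁆)) ⟩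
    rk X ℕ.+ 1                           ≡⟨ ℕₚ.+-comm (rk X) 1 ⟩
    suc (rk X)                           ∎
    where open ℕₚ.≤-Reasoning

  loopless⇒¬InClosure-⊥ : Loopless G → ∀ x → ¬ InClosure G ⊥ x
  loopless⇒¬InClosure-⊥ loopless x x∈cl⊥ =
    ℕₚ.1+n≢0 (≡.trans (≡.sym (loopless x)) (≡.trans (cong rk (≡.sym (∪-identityˡ ⁅ x ⁆))) (≡.trans x∈cl⊥ rk-⊥)))

  ¬InClosure⇒rk-∪⁅⁆ : ∀ X x → ¬ InClosure G X x → rk (X ∪ ⁅ x ⁆) ≡ suc (rk X)
  ¬InClosure⇒rk-∪⁅⁆ X x x∉cl = ℕₚ.≤-antisym (rk-∪⁅⁆≤ X x) (ℕₚ.≤∧≢⇒< (rk-mono (p⊆p∪q ⁅ x ⁆)) (x∉cl ∘ ≡.sym))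

module Levels {n} (G : Matroid n) (r : ℕ) (S : Subset n) (nbb : NBB G r S) where
  open Matroid G
  open Decide G r
  open RankProperties G

  ∈upperPart⁺ : ∀ s {t} → t ∈ S → s Fin.≤ t → t ∈ upperPart G S s
  ∈upperPart⁺ s t∈S s≤t = x∈p∩q⁺ (t∈S , ∈subsetOf⁺ (s Fin.≤?_) s≤t)

  ∈upperPart⁻ : ∀ s {t} → t ∈ upperPart G S s → t ∈ S × s Fin.≤ t
  ∈upperPart⁻ s t∈ with x∈p∩q⁻ S _ t∈
  ... | t∈S , s≤t = t∈S , ∈subsetOf⁻ (s Fin.≤?_) s≤t

  closureFrom : Fin n → Subset n
  closureFrom s = subsetOf (inRClosure? (upperPart G S s))

  ∈closureFrom⁺ : ∀ s {x} → InRClosure G r (upperPart G S s) x → x ∈ closureFrom s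
  ∈closureFrom⁺ s = ∈subsetOf⁺ (inRClosure? (upperPart G S s))

  ∈closureFrom⁻ : ∀ s {x} → x ∈ closureFrom s → InRClosure G r (upperPart G S s) x
  ∈closureFrom⁻ s = ∈subsetOf⁻ (inRClosure? (upperPart G S s))

  closureFrom-rClosed : ∀ s → RClosed G r (closureFrom s)
  closureFrom-rClosed s T T⊆ T≤r i i∈clT = ∈closureFrom⁺ s λ X X-closed up⊆X →
    X-closed T (λ t∈T → ∈closureFrom⁻ s (T⊆ t∈T) X X-closed up⊆X) T≤r i i∈clT

  closureFrom-antitone : ∀ {s s′} → s Fin.≤ s′ → closureFrom s′ ⊆ closureFrom s
  closureFrom-antitone {s} {s′} s≤s′ x∈ = ∈closureFrom⁺ s λ X X-closed up⊆X →
    ∈closureFrom⁻ s′ x∈ X X-closed λ t∈ → let t∈S , s′≤t = ∈upperPart⁻ s′ t∈ in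
      up⊆X (∈upperPart⁺ s t∈S (Finₚ.≤-trans s≤s′ s′≤t))

  s∈closureFrom-s : ∀ {s} → s ∈ S → s ∈ closureFrom s
  s∈closureFrom-s {s} s∈S = ∈closureFrom⁺ s (λ X _ up⊆X → up⊆X (∈upperPart⁺ s s∈S Finₚ.≤-refl))

  closureFrom-above : ∀ {s x} → s ∈ S → x ∈ closureFrom s → s Fin.≤ x
  closureFrom-above {s} s∈S x∈ = nbb s s∈S _ (∈closureFrom⁻ s x∈)

  levelCandidate : Fin n → Fin n → ℕ
  levelCandidate x s = if does (s ∈? S) ∧ does (x ∈? closureFrom s) then suc (toℕ s) else 0

  level : Fin n → ℕ
  level x = maxOver (levelCandidate x)

  level-cases : ∀ x → level x ≡ 0 ⊎ ∃ λ s → s ∈ S × x ∈ closureFrom s × level x ≡ suc (toℕ s)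
  level-cases x with maxOver-attained (levelCandidate x)
  ... | inj₁ eq       = inj₁ eq
  ... | inj₂ (s , eq) with s ∈? S | x ∈? closureFrom s
  ...   | yes s∈S | yes x∈ = inj₂ (s , s∈S , x∈ , eq)
  ...   | yes _   | no  _  = inj₁ eq
  ...   | no  _   | _      = inj₁ eq

  closureFrom⇒level : ∀ {s x} → s ∈ S → x ∈ closureFrom s → suc (toℕ s) ℕ.≤ level x
  closureFrom⇒level {s} {x} s∈S x∈ = subst (ℕ._≤ level x) candidate (f≤maxOver (levelCandidate x) s)
    where
    candidate : levelCandidate x s ≡ suc (toℕ s)
    candidate with s ∈? S | x ∈? closureFrom s
    ... | yes _ | yes _  = refl
    ... | yes _ | no x∉ = ⊥-elim (x∉ x∈)
    ... | no s∉ | _     = ⊥-elim (s∉ s∈S)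

  level⇒closureFrom : ∀ {s x} → s ∈ S → suc (toℕ s) ℕ.≤ level x → x ∈ closureFrom s
  level⇒closureFrom {s} {x} s∈S s<level with level-cases x
  ... | inj₁ eq = ⊥-elim (ℕₚ.<⇒≱ (s≤s z≤n) (subst (suc (toℕ s) ℕ.≤_) eq s<level))
  ... | inj₂ (s′ , _ , x∈ , eq) = closureFrom-antitone (ℕₚ.≤-pred (subst (suc (toℕ s) ℕ.≤_) eq s<level)) x∈

  level-∈S : ∀ {s} → s ∈ S → level s ≡ suc (toℕ s)
  level-∈S {s} s∈S with level-cases s | closureFrom⇒level s∈S (s∈closureFrom-s s∈S)
  ... | inj₁ eq                   | s<level = ⊥-elim (ℕₚ.<⇒≱ (s≤s z≤n) (subst (suc (toℕ s) ℕ.≤_) eq s<level))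
  ... | inj₂ (s′ , s′∈S , s∈ , eq) | s<level =
    ≡.trans eq (cong suc (ℕₚ.≤-antisym (closureFrom-above s′∈S s∈) (ℕₚ.≤-pred (subst (suc (toℕ s) ℕ.≤_) eq s<level))))

  LevelInjective : Subset n → Set
  LevelInjective W = ∀ {x y} → x ∈ W → y ∈ W → level x ≡ level y → x ≡ y

  module _ (loopless : Loopless G) where

    -- All of T lies in closureFrom s for the least s ∈ S with level x ≤ s; being r-closed, that
    -- set then contains x, which forces level x > s.
    closure-not-below : ∀ T x → ∣ T ∣ ℕ.≤ r → InClosure G T x → ¬ (∀ {t} → t ∈ T → level x ℕ.< level t)
    closure-not-below T x T≤r x∈clT below with nonempty? T
    ... | no  empty = loopless⇒¬InClosure-⊥ loopless x (subst (λ Z → InClosure G Z x) (Empty-unique empty) x∈clT)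
    ... | yes (t₀ , t₀∈T) with level-cases t₀
    ...   | inj₁ eq₀ = ℕₚ.n≮0 (subst (level x ℕ.<_) eq₀ (below t₀∈T))
    ...   | inj₂ (s₀ , s₀∈S , _ , eq₀)
          with minimiser (λ s → (s ∈? S) ×-dec (level x ℕ.≤? toℕ s)) toℕ
                         (s₀ , s₀∈S , ℕₚ.≤-pred (subst (level x ℕ.<_) eq₀ (below t₀∈T)))
    ...     | s , (s∈S , level≤s) , least = ℕₚ.<⇒≱ (s≤s level≤s) (closureFrom⇒level s∈S x∈Y)
      where
      T⊆Y : T ⊆ closureFrom s
      T⊆Y {t} t∈T with level-cases t
      ... | inj₁ eq = ⊥-elim (ℕₚ.n≮0 (subst (level x ℕ.<_) eq (below t∈T)))
      ... | inj₂ (sₜ , sₜ∈S , _ , eq) =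
        level⇒closureFrom s∈S (subst (suc (toℕ s) ℕ.≤_) (≡.sym eq)
          (s≤s (least sₜ (sₜ∈S , ℕₚ.≤-pred (subst (level x ℕ.<_) eq (below t∈T))))))
      x∈Y : x ∈ closureFrom s
      x∈Y = closureFrom-rClosed s T T⊆Y T≤r x x∈clT

    -- Removing the point of least level lowers the rank, by closure-not-below.
    level-injective⇒independent : ∀ W → ∣ W ∣ ℕ.≤ suc r → LevelInjective W → rk W ≡ ∣ W ∣
    level-injective⇒independent W W≤ inj = go ∣ W ∣ W refl W≤ inj
      where
      go : ∀ k W → ∣ W ∣ ≡ k → k ℕ.≤ suc r → LevelInjective W → rk W ≡ k
      go zero    W ∣W∣≡0 _ _ = ℕₚ.n≤0⇒n≡0 (subst (rk W ℕ.≤_) ∣W∣≡0 (rk-bound W))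
      go (suc k) W ∣W∣≡ k<r inj with nonempty? W
      ... | no empty = ⊥-elim (ℕₚ.0≢1+n (≡.trans (≡.sym (∣⊥∣≡0 n)) (≡.trans (cong ∣_∣ (≡.sym (Empty-unique empty))) ∣W∣≡)))
      ... | yes w with minimiser (_∈? W) level w
      ...   | x , x∈W , least = begin
        rk W                    ≡⟨ cong rk (≡.sym (x∈p⇒p-x∪⁅x⁆≡p x∈W)) ⟩
        rk ((W - x) ∪ ⁅ x ⁆)    ≡⟨ ¬InClosure⇒rk-∪⁅⁆ (W - x) x x∉cl ⟩
        suc (rk (W - x))        ≡⟨ cong suc (go k (W - x) ∣W-x∣≡k (ℕₚ.≤-trans (ℕₚ.n≤1+n k) k<r)
                                                (λ a∈ b∈ → inj (p─q⊆p W _ a∈) (p─q⊆p W _ b∈))) ⟩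
        suc k                   ∎
        where
        open ≡-Reasoning
        ∣W-x∣≡k : ∣ W - x ∣ ≡ k
        ∣W-x∣≡k = ℕₚ.suc-injective (≡.trans (x∈p⇒1+∣p-x∣≡∣p∣ x∈W) ∣W∣≡)
        x∉cl : ¬ InClosure G (W - x) x
        x∉cl x∈cl = closure-not-below (W - x) x (subst (ℕ._≤ r) (≡.sym ∣W-x∣≡k) (ℕₚ.≤-pred k<r)) x∈cl
          λ {t} t∈ → ℕₚ.≤∧≢⇒< (least t (p─q⊆p W _ t∈)) (λ eq → y∈p-x⇒y≢x W t∈ (≡.sym (inj x∈W (p─q⊆p W _ t∈) eq)))

module Transversals {n} (G : Matroid n) (r : ℕ) (S : Subset n) (nbb : NBB G r S) where
  open Levels G r S nbb

  _<ᴸ_ : Fin n → Fin n → Bool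
  x <ᴸ y = does (level x ℕ.<? level y)

  inverted : Fin n → Fin n → Bool
  inverted x y = (x <ᵇ y) ∧ (y <ᴸ x)

  levelInversions : Subset n → Bool
  levelInversions W = oddCount W (λ x → oddCount W (inverted x))

  record Transversal (W : Subset n) : Set where
    field
      injective : LevelInjective W
      covers    : ∀ {s} → s ∈ S → ∃ λ t → t ∈ W × level t ≡ suc (toℕ s)

  transversal? : ∀ W → Dec (Transversal W)
  transversal? W = map′ (λ (inj , cov) → record { injective = λ {x} {y} → inj x y ; covers = λ {s} → cov s })
                        (λ t → (λ x y → Transversal.injective t) , (λ s → Transversal.covers t))
                        (injective? ×-dec covers?)
    where
    injective? : Dec (∀ x y → x ∈ W → y ∈ W → level x ≡ level y → x ≡ y)
    injective? = Finₚ.all? λ x → Finₚ.all? λ y →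
                   (x ∈? W) →-dec (y ∈? W) →-dec (level x ℕ.≟ level y) →-dec (x Finₚ.≟ y)
    covers? : Dec (∀ s → s ∈ S → ∃ λ t → t ∈ W × level t ≡ suc (toℕ s))
    covers? = Finₚ.all? λ s → (s ∈? S) →-dec Finₚ.any? λ t → (t ∈? W) ×-dec (level t ℕ.≟ suc (toℕ s))

  transversal-swap : ∀ V {c u} → u ∉ V → level c ≡ level u → Transversal (V ∪ ⁅ u ⁆) → Transversal (V ∪ ⁅ c ⁆)
  transversal-swap V {c} {u} u∉V same t = record { injective = injective′ ; covers = covers′ }
    where
    open Transversal t
    u∈V-if-same : ∀ {x} → x ∈ V → level x ≡ level c → u ∈ V
    u∈V-if-same x∈V eq = subst (_∈ V) (injective (x∈p⇒x∈p∪⁅y⁆ x∈V) x∈p∪⁅x⁆ (≡.trans eq same)) x∈V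
    injective′ : LevelInjective (V ∪ ⁅ c ⁆)
    injective′ {x} {y} x∈ y∈ eq with x∈p∪⁅y⁆⁻ V x∈ | x∈p∪⁅y⁆⁻ V y∈
    ... | inj₁ x∈V | inj₁ y∈V = injective (x∈p⇒x∈p∪⁅y⁆ x∈V) (x∈p⇒x∈p∪⁅y⁆ y∈V) eq
    ... | inj₁ x∈V | inj₂ refl = ⊥-elim (u∉V (u∈V-if-same x∈V eq))
    ... | inj₂ refl | inj₁ y∈V = ⊥-elim (u∉V (u∈V-if-same y∈V (≡.sym eq)))
    ... | inj₂ refl | inj₂ refl = refl
    covers′ : ∀ {s} → s ∈ S → ∃ λ t → t ∈ V ∪ ⁅ c ⁆ × level t ≡ suc (toℕ s)
    covers′ s∈S with covers s∈S
    ... | t , t∈ , eq with x∈p∪⁅y⁆⁻ V t∈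
    ...   | inj₁ t∈V = t , x∈p⇒x∈p∪⁅y⁆ t∈V , eq
    ...   | inj₂ refl = c , x∈p∪⁅x⁆ , ≡.trans same eq

  levelInversions-insert : ∀ V {u} → u ∉ V →
    levelInversions (V ∪ ⁅ u ⁆) ≡ levelInversions V xor oddCount V (λ w → inverted w u xor inverted u w)
  levelInversions-insert V {u} u∉V = begin≡
    oddCount (V ∪ ⁅ u ⁆) (λ x → oddCount (V ∪ ⁅ u ⁆) (inverted x))
      ≡⟨ oddCount-cong (V ∪ ⁅ u ⁆) (λ {x} _ → oddCount-insert V u∉V (inverted x)) ⟩
    oddCount (V ∪ ⁅ u ⁆) (λ x → A x xor inverted x u)
      ≡⟨ oddCount-insert V u∉V _ ⟩
    oddCount V (λ x → A x xor inverted x u) xor (A u xor inverted u u)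
      ≡⟨ cong₂ _xor_ (oddCount-xor V A (λ x → inverted x u)) (cong (A u xor_) (cong (_∧ (u <ᴸ u)) (<ᵇ-irrefl u))) ⟩
    (levelInversions V xor oddCount V (λ x → inverted x u)) xor (A u xor false)
      ≡⟨ regroup (levelInversions V) (oddCount V (λ x → inverted x u)) (A u) ⟩
    levelInversions V xor (oddCount V (λ x → inverted x u) xor A u)
      ≡⟨ cong (levelInversions V xor_) (≡.sym (oddCount-xor V (λ w → inverted w u) (inverted u))) ⟩
    levelInversions V xor oddCount V (λ w → inverted w u xor inverted u w)
      ∎≡
    where
    open ≡-Reasoning renaming (begin_ to begin≡_; _∎ to _∎≡)
    open XorSolver
    A : Fin n → Bool
    A x = oddCount V (inverted x)
    regroup : ∀ a b c → (a xor b) xor (c xor false) ≡ a xor (b xor c)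
    regroup = solve 3 (λ a b c → (a :+ b) :+ (c :+ con false) := a :+ (b :+ c)) refl

  inverted-pair : ∀ {w u} → w ≢ u → level w ≢ level u →
                  inverted w u xor inverted u w ≡ not ((w <ᵇ u) xor (u <ᴸ w))
  inverted-pair {w} {u} w≢u lw≢lu =
    ≡.trans (cong (inverted w u xor_) (cong₂ _∧_ (<ᵇ-flip w≢u) (does<?-flip (lw≢lu ∘ ≡.sym))))
            (pair (w <ᵇ u) (u <ᴸ w))
    where
    open XorSolver
    pair : ∀ a b → (a ∧ b) xor (not a ∧ not b) ≡ not (a xor b)
    pair = solve 2 (λ a b → (a :* b) :+ ((con true :+ a) :* (con true :+ b)) := con true :+ (a :+ b)) refl

  levelInversions-swap : ∀ V {c u} → c ∉ V → u ∉ V → level c ≡ level u → LevelInjective (V ∪ ⁅ u ⁆) →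
                         levelInversions (V ∪ ⁅ u ⁆) ≡ between V c u xor levelInversions (V ∪ ⁅ c ⁆)
  levelInversions-swap V {c} {u} c∉V u∉V same inj = begin
    levelInversions (V ∪ ⁅ u ⁆)                           ≡⟨ levelInversions-insert V u∉V ⟩
    levelInversions V xor crossings u                     ≡⟨ cong (levelInversions V xor_) crossings-u ⟩
    levelInversions V xor (between V c u xor crossings c) ≡⟨ rotate (levelInversions V) (between V c u) (crossings c) ⟩
    between V c u xor (levelInversions V xor crossings c) ≡⟨ cong (between V c u xor_) (≡.sym (levelInversions-insert V c∉V)) ⟩
    between V c u xor levelInversions (V ∪ ⁅ c ⁆)         ∎
    where
    open ≡-Reasoning
    open XorSolver
    crossings : Fin n → Bool
    crossings u = oddCount V (λ w → inverted w u xor inverted u w)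
    rotate : ∀ a b x → a xor (b xor x) ≡ b xor (a xor x)
    rotate = solve 3 (λ a b x → a :+ (b :+ x) := b :+ (a :+ x)) refl
    exchange : ∀ a b t → not (a xor t) ≡ (a xor b) xor not (b xor t)
    exchange = solve 3 (λ a b t → con true :+ (a :+ t) := (a :+ b) :+ (con true :+ (b :+ t))) refl
    pointwise : ∀ {w} → w ∈ V → inverted w u xor inverted u w ≡ ((w <ᵇ u) xor (w <ᵇ c)) xor (inverted w c xor inverted c w)
    pointwise {w} w∈V = begin
      inverted w u xor inverted u w                              ≡⟨ inverted-pair w≢u lw≢lu ⟩
      not ((w <ᵇ u) xor (u <ᴸ w))                                ≡⟨ exchange (w <ᵇ u) (w <ᵇ c) (u <ᴸ w) ⟩
      ((w <ᵇ u) xor (w <ᵇ c)) xor not ((w <ᵇ c) xor (u <ᴸ w))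
        ≡⟨ cong (λ ℓ → ((w <ᵇ u) xor (w <ᵇ c)) xor not ((w <ᵇ c) xor does (ℓ ℕ.<? level w))) (≡.sym same) ⟩
      ((w <ᵇ u) xor (w <ᵇ c)) xor not ((w <ᵇ c) xor (c <ᴸ w))
        ≡⟨ cong (((w <ᵇ u) xor (w <ᵇ c)) xor_) (≡.sym (inverted-pair w≢c (lw≢lu ∘ (λ eq → ≡.trans eq same)))) ⟩
      ((w <ᵇ u) xor (w <ᵇ c)) xor (inverted w c xor inverted c w) ∎
      where
      w≢u : w ≢ u
      w≢u refl = u∉V w∈V
      w≢c : w ≢ c
      w≢c refl = c∉V w∈V
      lw≢lu : level w ≢ level u
      lw≢lu eq = w≢u (inj (x∈p⇒x∈p∪⁅y⁆ w∈V) x∈p∪⁅x⁆ eq)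
    crossings-u : crossings u ≡ between V c u xor crossings c
    crossings-u = ≡.trans (oddCount-cong V pointwise)
                          (≡.trans (oddCount-xor V _ _) (cong (_xor crossings c) (oddCount-xor V (_<ᵇ u) (_<ᵇ c))))

-- The colexicographic order

-- Bit i of colexRank T is set iff i ∉ T, so T has the smaller rank when the largest element
-- on which T and S differ lies in T.
colexRank : ∀ {n} → Subset n → ℕ
colexRank []      = 0
colexRank (b ∷ T) = indicator (not b) ℕ.+ 2 ℕ.* colexRank T

AgreeAbove : ∀ {n} → Fin n → Subset n → Subset n → Set
AgreeAbove x T S = ∀ {y} → x Fin.< y → (y ∈ T → y ∈ S) × (y ∈ S → y ∈ T)

agreeAbove-there : ∀ {n} {x : Fin n} {t s T S} → AgreeAbove (suc x) (t ∷ T) (s ∷ S) → AgreeAbove x T S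
agreeAbove-there agree x<y with agree (s≤s x<y)
... | T⊆S , S⊆T = (λ y∈T → drop-there (T⊆S (there y∈T))) , (λ y∈S → drop-there (S⊆T (there y∈S)))

colexRank-< : ∀ {n} {x : Fin n} {T S} → x ∈ T → x ∉ S → AgreeAbove x T S → colexRank T ℕ.< colexRank S
colexRank-< {x = zero} {inside ∷ T} {outside ∷ S} here x∉S agree =
  subst (λ k → 2 ℕ.* colexRank T ℕ.< 1 ℕ.+ 2 ℕ.* k) (cong colexRank T≡S) (ℕₚ.n<1+n _)
  where
  T≡S : T ≡ S
  T≡S = ⊆-antisym (λ y∈T → drop-there (proj₁ (agree (s≤s z≤n)) (there y∈T)))
                  (λ y∈S → drop-there (proj₂ (agree (s≤s z≤n)) (there y∈S)))
colexRank-< {x = zero} {inside ∷ T} {inside ∷ S} here x∉S agree = ⊥-elim (x∉S here)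
colexRank-< {x = suc x} {t ∷ T} {s ∷ S} (there x∈T) x∉S agree = begin-strict
  indicator (not t) ℕ.+ 2 ℕ.* colexRank T   ≤⟨ ℕₚ.+-monoˡ-≤ _ (indicator≤1 (not t)) ⟩
  1 ℕ.+ 2 ℕ.* colexRank T                   <⟨ ℕₚ.n<1+n _ ⟩
  2 ℕ.+ 2 ℕ.* colexRank T                   ≡⟨ ℕₚ.*-suc 2 (colexRank T) ⟨
  2 ℕ.* suc (colexRank T)                   ≤⟨ ℕₚ.*-monoʳ-≤ 2 (colexRank-< x∈T (x∉S ∘ there) (agreeAbove-there agree)) ⟩
  2 ℕ.* colexRank S                         ≤⟨ ℕₚ.m≤n+m _ (indicator (not s)) ⟩
  indicator (not s) ℕ.+ 2 ℕ.* colexRank S   ∎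
  where
  open ℕₚ.≤-Reasoning
  indicator≤1 : ∀ b → indicator b ℕ.≤ 1
  indicator≤1 true  = ℕₚ.≤-refl
  indicator≤1 false = z≤n

highest-difference : ∀ {n} {T S : Subset n} → T ≢ S →
                     ∃ λ x → ((x ∈ T × x ∉ S) ⊎ (x ∉ T × x ∈ S)) × AgreeAbove x T S
highest-difference {T = []}    {[]}    T≢S = ⊥-elim (T≢S refl)
highest-difference {T = t ∷ T} {s ∷ S} T≢S with T ≟S S
... | yes refl = zero , head-differs t s (T≢S ∘ cong (_∷ T)) , agree
  where
  head-differs : ∀ t s → t ≢ s → (zero ∈ t ∷ T × zero ∉ s ∷ T) ⊎ (zero ∉ t ∷ T × zero ∈ s ∷ T)
  head-differs inside  outside _   = inj₁ (here , λ ())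
  head-differs outside inside  _   = inj₂ ((λ ()) , here)
  head-differs inside  inside  t≢s = ⊥-elim (t≢s refl)
  head-differs outside outside t≢s = ⊥-elim (t≢s refl)
  agree : AgreeAbove zero (t ∷ T) (s ∷ T)
  agree {suc y} _ = (λ y∈ → there (drop-there y∈)) , (λ y∈ → there (drop-there y∈))
... | no T′≢S′ with highest-difference T′≢S′
...   | x , differs , agree = suc x , lift differs , agree′
  where
  lift : (x ∈ T × x ∉ S) ⊎ (x ∉ T × x ∈ S) → (suc x ∈ t ∷ T × suc x ∉ s ∷ S) ⊎ (suc x ∉ t ∷ T × suc x ∈ s ∷ S)
  lift (inj₁ (x∈T , x∉S)) = inj₁ (there x∈T , x∉S ∘ drop-there)
  lift (inj₂ (x∉T , x∈S)) = inj₂ (x∉T ∘ drop-there , there x∈S)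
  agree′ : AgreeAbove (suc x) (t ∷ T) (s ∷ S)
  agree′ {suc y} (s≤s x<y) with agree x<y
  ... | T⊆S , S⊆T = (λ y∈ → there (T⊆S (drop-there y∈))) , (λ y∈ → there (S⊆T (drop-there y∈)))

-- The functional dual to an r-nbb monomial

module DualFunctional {c ℓ} (R : CommutativeRing c ℓ) {n} (G : Matroid n) (loopless : Loopless G)
                       (r : ℕ) (S : Subset n) (nbb : NBB G r S) where
  open CommutativeRing R renaming (refl to ≈-refl) hiding (zero; _-_)
  open import Relation.Binary.Reasoning.Setoid setoid
  open ListSum R
  open Signs R
  open Pairing R n
  open Levels G r S nbb
  open Transversals G r S nbb
  open import Algebra.Properties.Ring ring using (-‿distribˡ-*)

  SameLevelVanishing : Functional → Set ℓ
  SameLevelVanishing ψ = ∀ W {x y} → x ≢ y → x ∈ W → y ∈ W → level x ≡ level y → ψ W ≈ 0#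

  LevelSwap : Functional → Set ℓ
  LevelSwap ψ = ∀ V {c u} → c ≢ u → c ∉ V → u ∉ V → level c ≡ level u →
                ψ (V ∪ ⁅ u ⁆) ≈ sign (between V c u) * ψ (V ∪ ⁅ c ⁆)

  record LevelCompatible (ψ : Functional) : Set ℓ where
    field
      vanishing : SameLevelVanishing ψ
      swap      : LevelSwap ψ

  VanishesAbove : Functional → Set ℓ
  VanishesAbove ψ = ∀ W → r ℕ.< ∣ W ∣ → ψ W ≈ 0#

  φ : Functional
  φ W with transversal? W
  ... | yes _ = sign (levelInversions W)
  ... | no  _ = 0#

  φ-compatible : LevelCompatible φ
  φ-compatible = record { vanishing = vanishing ; swap = swap }
    where
    vanishing : SameLevelVanishing φ
    vanishing W x≢y x∈W y∈W eq with transversal? W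
    ... | yes t = ⊥-elim (x≢y (Transversal.injective t x∈W y∈W eq))
    ... | no  _ = ≈-refl
    swap : LevelSwap φ
    swap V {c} {u} c≢u c∉V u∉V same with transversal? (V ∪ ⁅ u ⁆) | transversal? (V ∪ ⁅ c ⁆)
    ... | yes tu  | yes _   = trans (reflexive (cong sign (levelInversions-swap V c∉V u∉V same (Transversal.injective tu))))
                                    (sign-xor (between V c u) _)
    ... | yes tu  | no  ¬tc = ⊥-elim (¬tc (transversal-swap V u∉V same tu))
    ... | no  ¬tu | yes tc  = ⊥-elim (¬tu (transversal-swap V c∉V (≡.sym same) tc))
    ... | no  _   | no  _   = sym (zeroʳ _)

  module _ {ψ : Functional} (compatible : LevelCompatible ψ) where
    open LevelCompatible compatible

    ⋀-pair : ∀ A B {x y} → x ≢ y → x ∈ A ∪ B → y ∈ A ∪ B → level x ≡ level y → ⟨ ψ ∣ A ⋀ B ⟩ ≈ 0#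
    ⋀-pair A B x≢y x∈ y∈ same = ⋀-vanishes ψ A B (λ _ → vanishing (A ∪ B) x≢y x∈ y∈ same)

    private
      both-zero : ∀ b {L R} → L ≈ 0# → R ≈ 0# → L ≈ sign b * R
      both-zero b L≈0 R≈0 = trans L≈0 (sym (trans (*-congˡ R≈0) (zeroʳ _)))

    ⋀-swapʳ : ∀ V B {c u} → c ≢ u → c ∉ V → u ∉ V → level c ≡ level u →
              ⟨ ψ ∣ (V ∪ ⁅ u ⁆) ⋀ B ⟩ ≈ sign (between V c u) * ⟨ ψ ∣ (V ∪ ⁅ c ⁆) ⋀ B ⟩
    ⋀-swapʳ V B {c} {u} c≢u c∉V u∉V same with c ∈? B | u ∈? B | (V ∩ B) ≟S ⊥
    ... | yes c∈B | _       | _ = both-zero (between V c u)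
      (⋀-pair (V ∪ ⁅ u ⁆) B c≢u (x∈p∪q⁺ (inj₂ c∈B)) (x∈p∪q⁺ (inj₁ x∈p∪⁅x⁆)) same)
      (⋀-meets ψ (V ∪ ⁅ c ⁆) B x∈p∪⁅x⁆ c∈B)
    ... | no _    | yes u∈B | _ = both-zero (between V c u)
      (⋀-meets ψ (V ∪ ⁅ u ⁆) B x∈p∪⁅x⁆ u∈B)
      (⋀-pair (V ∪ ⁅ c ⁆) B c≢u (x∈p∪q⁺ (inj₁ x∈p∪⁅x⁆)) (x∈p∪q⁺ (inj₂ u∈B)) same)
    ... | no _    | no _    | no V∩B≢⊥ with p∩q≢⊥⇒∃ V B V∩B≢⊥
    ...   | x , x∈V , x∈B = both-zero (between V c u)
      (⋀-meets ψ (V ∪ ⁅ u ⁆) B (x∈p⇒x∈p∪⁅y⁆ x∈V) x∈B) (⋀-meets ψ (V ∪ ⁅ c ⁆) B (x∈p⇒x∈p∪⁅y⁆ x∈V) x∈B)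
    ⋀-swapʳ V B {c} {u} c≢u c∉V u∉V same | no c∉B | no u∉B | yes V∩B≡⊥ = begin
      ⟨ ψ ∣ (V ∪ ⁅ u ⁆) ⋀ B ⟩
        ≈⟨ ⋀-disjoint ψ (V ∪ ⁅ u ⁆) B (p∩q≡⊥⇒p∪⁅x⁆∩q≡⊥ V∩B≡⊥ u∉B) ⟩
      sign (inversionParity (V ∪ ⁅ u ⁆) B) * ψ ((V ∪ ⁅ u ⁆) ∪ B)
        ≈⟨ sign-transfer (inversionParity (V ∪ ⁅ u ⁆) B) (between (V ∪ B) c u)
                         (inversionParity (V ∪ ⁅ c ⁆) B) (between V c u) parities swapped ⟩
      sign (between V c u) * (sign (inversionParity (V ∪ ⁅ c ⁆) B) * ψ ((V ∪ ⁅ c ⁆) ∪ B))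
        ≈⟨ *-congˡ (⋀-disjoint ψ (V ∪ ⁅ c ⁆) B (p∩q≡⊥⇒p∪⁅x⁆∩q≡⊥ V∩B≡⊥ c∉B)) ⟨
      sign (between V c u) * ⟨ ψ ∣ (V ∪ ⁅ c ⁆) ⋀ B ⟩
        ∎
      where
      open XorSolver
      rearrange : ∀ x → (V ∪ B) ∪ ⁅ x ⁆ ≡ (V ∪ ⁅ x ⁆) ∪ B
      rearrange x = ≡.trans (∪-assoc V B ⁅ x ⁆) (≡.trans (cong (V ∪_) (∪-comm B ⁅ x ⁆)) (≡.sym (∪-assoc V ⁅ x ⁆ B)))
      swapped : ψ ((V ∪ ⁅ u ⁆) ∪ B) ≈ sign (between (V ∪ B) c u) * ψ ((V ∪ ⁅ c ⁆) ∪ B)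
      swapped = ≡.subst₂ (λ X Y → ψ X ≈ sign (between (V ∪ B) c u) * ψ Y) (rearrange u) (rearrange c)
                  (swap (V ∪ B) c≢u (x∉p∪q c∉V c∉B) (x∉p∪q u∉V u∉B) same)
      regroup : ∀ i bu bc vu vc → (i xor bu) xor ((vu xor vc) xor (bu xor bc)) ≡ (vu xor vc) xor (i xor bc)
      regroup = solve 5 (λ i bu bc vu vc → (i :+ bu) :+ ((vu :+ vc) :+ (bu :+ bc)) := (vu :+ vc) :+ (i :+ bc)) refl
      parities : inversionParity (V ∪ ⁅ u ⁆) B xor between (V ∪ B) c u ≡ between V c u xor inversionParity (V ∪ ⁅ c ⁆) B
      parities = ≡.trans (cong₂ _xor_ (inversionParity-insertˡ V B u∉V) (between-∪ V B V∩B≡⊥ c u))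
                 (≡.trans (regroup (inversionParity V B) (below B u) (below B c) (below V u) (below V c))
                          (cong (between V c u xor_) (≡.sym (inversionParity-insertˡ V B c∉V))))

    ⋀-swapˡ : ∀ A V {c u} → c ≢ u → c ∉ V → u ∉ V → level c ≡ level u →
              ⟨ ψ ∣ A ⋀ (V ∪ ⁅ u ⁆) ⟩ ≈ sign (between V c u) * ⟨ ψ ∣ A ⋀ (V ∪ ⁅ c ⁆) ⟩
    ⋀-swapˡ A V {c} {u} c≢u c∉V u∉V same with c ∈? A | u ∈? A | (A ∩ V) ≟S ⊥
    ... | yes c∈A | _       | _ = both-zero (between V c u)
      (⋀-pair A (V ∪ ⁅ u ⁆) c≢u (x∈p∪q⁺ (inj₁ c∈A)) (x∈p∪q⁺ (inj₂ x∈p∪⁅x⁆)) same)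
      (⋀-meets ψ A (V ∪ ⁅ c ⁆) c∈A x∈p∪⁅x⁆)
    ... | no _    | yes u∈A | _ = both-zero (between V c u)
      (⋀-meets ψ A (V ∪ ⁅ u ⁆) u∈A x∈p∪⁅x⁆)
      (⋀-pair A (V ∪ ⁅ c ⁆) c≢u (x∈p∪q⁺ (inj₂ x∈p∪⁅x⁆)) (x∈p∪q⁺ (inj₁ u∈A)) same)
    ... | no _    | no _    | no A∩V≢⊥ with p∩q≢⊥⇒∃ A V A∩V≢⊥
    ...   | x , x∈A , x∈V = both-zero (between V c u)
      (⋀-meets ψ A (V ∪ ⁅ u ⁆) x∈A (x∈p⇒x∈p∪⁅y⁆ x∈V)) (⋀-meets ψ A (V ∪ ⁅ c ⁆) x∈A (x∈p⇒x∈p∪⁅y⁆ x∈V))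
    ⋀-swapˡ A V {c} {u} c≢u c∉V u∉V same | no c∉A | no u∉A | yes A∩V≡⊥ = begin
      ⟨ ψ ∣ A ⋀ (V ∪ ⁅ u ⁆) ⟩
        ≈⟨ ⋀-disjoint ψ A (V ∪ ⁅ u ⁆) (p∩q≡⊥⇒p∩q∪⁅x⁆≡⊥ A∩V≡⊥ u∉A) ⟩
      sign (inversionParity A (V ∪ ⁅ u ⁆)) * ψ (A ∪ (V ∪ ⁅ u ⁆))
        ≈⟨ sign-transfer (inversionParity A (V ∪ ⁅ u ⁆)) (between (A ∪ V) c u)
                         (inversionParity A (V ∪ ⁅ c ⁆)) (between V c u) parities swapped ⟩
      sign (between V c u) * (sign (inversionParity A (V ∪ ⁅ c ⁆)) * ψ (A ∪ (V ∪ ⁅ c ⁆)))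
        ≈⟨ *-congˡ (⋀-disjoint ψ A (V ∪ ⁅ c ⁆) (p∩q≡⊥⇒p∩q∪⁅x⁆≡⊥ A∩V≡⊥ c∉A)) ⟨
      sign (between V c u) * ⟨ ψ ∣ A ⋀ (V ∪ ⁅ c ⁆) ⟩
        ∎
      where
      open XorSolver
      swapped : ψ (A ∪ (V ∪ ⁅ u ⁆)) ≈ sign (between (A ∪ V) c u) * ψ (A ∪ (V ∪ ⁅ c ⁆))
      swapped = ≡.subst₂ (λ X Y → ψ X ≈ sign (between (A ∪ V) c u) * ψ Y) (∪-assoc A V ⁅ u ⁆) (∪-assoc A V ⁅ c ⁆)
                  (swap (A ∪ V) c≢u (x∉p∪q c∉A c∉V) (x∉p∪q u∉A u∉V) same)
      regroup : ∀ i au ac w → (i xor au) xor ((au xor ac) xor w) ≡ w xor (i xor ac)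
      regroup = solve 4 (λ i au ac w → (i :+ au) :+ ((au :+ ac) :+ w) := w :+ (i :+ ac)) refl
      parities : inversionParity A (V ∪ ⁅ u ⁆) xor between (A ∪ V) c u ≡ between V c u xor inversionParity A (V ∪ ⁅ c ⁆)
      parities = ≡.trans (cong₂ _xor_ (inversionParity-insertʳ A V u∉V)
                                      (≡.trans (between-∪ A V A∩V≡⊥ c u) (cong (_xor between V c u) (between-above A c∉A u∉A))))
                 (≡.trans (regroup (inversionParity A V) (oddCount A (u <ᵇ_)) (oddCount A (c <ᵇ_)) (between V c u))
                          (cong (between V c u xor_) (≡.sym (inversionParity-insertʳ A V c∉V))))

    ▷-compatible : ∀ b → LevelCompatible (ψ ▷ b)
    ▷-compatible b = record
      { vanishing = λ W x≢y x∈W y∈W same → ▷-vanishes ψ b W λ T →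
          ⋀-pair W T x≢y (x∈p∪q⁺ (inj₁ x∈W)) (x∈p∪q⁺ (inj₁ y∈W)) same
      ; swap = λ V {c} {u} c≢u c∉V u∉V same → ▷-scales ψ b (V ∪ ⁅ u ⁆) (V ∪ ⁅ c ⁆) _ (λ T → ⋀-swapʳ V T c≢u c∉V u∉V same)
      }

    ◁-compatible : ∀ a → LevelCompatible (ψ ◁ a)
    ◁-compatible a = record
      { vanishing = λ W x≢y x∈W y∈W same → ◁-vanishes ψ a W λ T →
          ⋀-pair T W x≢y (x∈p∪q⁺ (inj₂ x∈W)) (x∈p∪q⁺ (inj₂ y∈W)) same
      ; swap = λ V {c} {u} c≢u c∉V u∉V same → ◁-scales ψ a (V ∪ ⁅ u ⁆) (V ∪ ⁅ c ⁆) _ (λ T → ⋀-swapˡ T V c≢u c∉V u∉V same)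
      }

  ▷-vanishesAbove : ∀ {ψ} → VanishesAbove ψ → ∀ b → VanishesAbove (ψ ▷ b)
  ▷-vanishesAbove {ψ} above b W r<∣W∣ = ▷-vanishes ψ b W λ T → ⋀-vanishes ψ W T λ _ →
    above (W ∪ T) (ℕₚ.<-≤-trans r<∣W∣ (∣p∣≤∣p∪q∣ W T))

  ◁-vanishesAbove : ∀ {ψ} → VanishesAbove ψ → ∀ a → VanishesAbove (ψ ◁ a)
  ◁-vanishesAbove {ψ} above a W r<∣W∣ = ◁-vanishes ψ a W λ T → ⋀-vanishes ψ T W λ _ →
    above (T ∪ W) (ℕₚ.<-≤-trans r<∣W∣ (∣q∣≤∣p∪q∣ T W))

  truncate : Functional → Functional
  truncate ψ W with ∣ W ∣ ℕ.≤? r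
  ... | yes _ = ψ W
  ... | no  _ = 0#

  truncate-vanishesAbove : ∀ ψ → VanishesAbove (truncate ψ)
  truncate-vanishesAbove ψ W r<∣W∣ with ∣ W ∣ ℕ.≤? r
  ... | yes ∣W∣≤r = ⊥-elim (ℕₚ.<⇒≱ r<∣W∣ ∣W∣≤r)
  ... | no  _     = ≈-refl

  truncate-compatible : ∀ {ψ} → LevelCompatible ψ → LevelCompatible (truncate ψ)
  truncate-compatible {ψ} compatible = record { vanishing = vanishing′ ; swap = swap′ }
    where
    open LevelCompatible compatible
    vanishing′ : SameLevelVanishing (truncate ψ)
    vanishing′ W x≢y x∈W y∈W same with ∣ W ∣ ℕ.≤? r
    ... | yes _ = vanishing W x≢y x∈W y∈W same
    ... | no  _ = ≈-refl
    equal-size : ∀ {V c u} → c ∉ V → u ∉ V → ∣ V ∪ ⁅ u ⁆ ∣ ≡ ∣ V ∪ ⁅ c ⁆ ∣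
    equal-size c∉V u∉V = ≡.trans (x∉p⇒∣p∪⁅x⁆∣≡1+∣p∣ u∉V) (≡.sym (x∉p⇒∣p∪⁅x⁆∣≡1+∣p∣ c∉V))
    swap′ : LevelSwap (truncate ψ)
    swap′ V {c} {u} c≢u c∉V u∉V same with ∣ V ∪ ⁅ u ⁆ ∣ ℕ.≤? r | ∣ V ∪ ⁅ c ⁆ ∣ ℕ.≤? r
    ... | yes _  | yes _  = swap V c≢u c∉V u∉V same
    ... | yes ≤r | no ≰r  = ⊥-elim (≰r (subst (ℕ._≤ r) (equal-size c∉V u∉V) ≤r))
    ... | no ≰r  | yes ≤r = ⊥-elim (≰r (subst (ℕ._≤ r) (equal-size u∉V c∉V) ≤r))
    ... | no _   | no _   = sym (zeroʳ _)

  ⟨truncate∣⟩ : ∀ ψ {y} → Exterior.DegLe R n r y → ⟨ truncate ψ ∣ y ⟩ ≈ ⟨ ψ ∣ y ⟩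
  ⟨truncate∣⟩ ψ {y} low = ∑-cong (allSubsets n) pointwise
    where
    pointwise : ∀ V → y V * truncate ψ V ≈ y V * ψ V
    pointwise V with ∣ V ∣ ℕ.≤? r
    ... | yes _ = ≈-refl
    ... | no  ≰r = trans (zeroʳ _) (sym (trans (*-congʳ (low V (ℕₚ.≰⇒> ≰r))) (zeroˡ _)))

  swapped-terms-cancel : ∀ {ν} → LevelSwap ν → ∀ V {c u} → c ≢ u → c ∉ V → u ∉ V → level c ≡ level u →
    sign (below ((V ∪ ⁅ u ⁆) ∪ ⁅ c ⁆) c) * ν (V ∪ ⁅ u ⁆) + sign (below ((V ∪ ⁅ u ⁆) ∪ ⁅ c ⁆) u) * ν (V ∪ ⁅ c ⁆) ≈ 0#
  swapped-terms-cancel {ν} swap V {c} {u} c≢u c∉V u∉V same = begin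
    sign βc * ν (V ∪ ⁅ u ⁆) + sign βu * ν (V ∪ ⁅ c ⁆)
      ≈⟨ +-congʳ (*-congˡ (swap V c≢u c∉V u∉V same)) ⟩
    sign βc * (sign (between V c u) * ν (V ∪ ⁅ c ⁆)) + sign βu * ν (V ∪ ⁅ c ⁆)
      ≈⟨ +-congʳ (trans (sym (*-assoc _ _ _)) (*-congʳ (sym (sign-xor βc (between V c u))))) ⟩
    sign (βc xor between V c u) * ν (V ∪ ⁅ c ⁆) + sign βu * ν (V ∪ ⁅ c ⁆)
      ≡⟨ cong (λ b → sign b * ν (V ∪ ⁅ c ⁆) + sign βu * ν (V ∪ ⁅ c ⁆)) parities ⟩
    sign (not βu) * ν (V ∪ ⁅ c ⁆) + sign βu * ν (V ∪ ⁅ c ⁆)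
      ≈⟨ +-congʳ (trans (*-congʳ (sign-not βu)) (sym (-‿distribˡ-* _ _))) ⟩
    - (sign βu * ν (V ∪ ⁅ c ⁆)) + sign βu * ν (V ∪ ⁅ c ⁆)
      ≈⟨ -‿inverseˡ _ ⟩
    0# ∎
    where
    βc βu : Bool
    βc = below ((V ∪ ⁅ u ⁆) ∪ ⁅ c ⁆) c
    βu = below ((V ∪ ⁅ u ⁆) ∪ ⁅ c ⁆) u
    parities : βc xor between V c u ≡ not βu
    parities = below-swapped-pair V c≢u c∉V u∉V

  ∂-vanishing : ∀ {ν} → LevelCompatible ν → VanishesAbove ν → ∀ C → Dependent G C → ⟨ ν ∣ Exterior.∂e R n C ⟩ ≈ 0#
  ∂-vanishing {ν} compatible above C dependent = trans (⟨∣∂e⟩ ν C) (by-size (∣ C ∣ ℕ.≤? suc r))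
    where
    open LevelCompatible compatible
    term : Fin n → Carrier
    term i = sign (below C i) * ν (C - i)
    by-size : Dec (∣ C ∣ ℕ.≤ suc r) → ∑ (elements C) term ≈ 0#
    by-size (no large) = ∑-elements-zero C term λ {i} i∈C →
      trans (*-congˡ (above (C - i) (ℕₚ.≤-pred (subst (suc r ℕ.<_) (≡.sym (x∈p⇒1+∣p-x∣≡∣p∣ i∈C)) (ℕₚ.≰⇒> large)))))
            (zeroʳ _)
    by-size (yes small) with Finₚ.any? (λ c → Finₚ.any? λ u →
                               (c ∈? C) ×-dec (u ∈? C) ×-dec ¬? (c Finₚ.≟ u) ×-dec (level c ℕ.≟ level u))
    ... | no ¬pair = ⊥-elim (ℕₚ.<-irrefl (level-injective⇒independent loopless C small injective) dependent)
      where
      injective : LevelInjective C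
      injective {x} {y} x∈C y∈C same with x Finₚ.≟ y
      ... | yes x≡y = x≡y
      ... | no  x≢y = ⊥-elim (¬pair (x , y , x∈C , y∈C , x≢y , same))
    ... | yes (c , u , c∈C , u∈C , c≢u , same) = trans (∑-elements-two C term c≢u c∈C u∈C others) pair
      where
      others : ∀ {i} → i ∈ C → i ≢ c → i ≢ u → term i ≈ 0#
      others i∈C i≢c i≢u =
        trans (*-congˡ (vanishing (C - _) c≢u (x∈p∧x≢y⇒x∈p-y c∈C (i≢c ∘ ≡.sym)) (x∈p∧x≢y⇒x∈p-y u∈C (i≢u ∘ ≡.sym)) same))
              (zeroʳ _)
      V : Subset n
      V = C - c - u
      C-c≡V∪u : C - c ≡ V ∪ ⁅ u ⁆
      C-c≡V∪u = ≡.sym (x∈p⇒p-x∪⁅x⁆≡p (x∈p∧x≢y⇒x∈p-y u∈C (c≢u ∘ ≡.sym)))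
      C-u≡V∪c : C - u ≡ V ∪ ⁅ c ⁆
      C-u≡V∪c = ≡.sym (≡.trans (cong (_∪ ⁅ c ⁆) (p─x─y≡p─y─x C c u)) (x∈p⇒p-x∪⁅x⁆≡p (x∈p∧x≢y⇒x∈p-y c∈C c≢u)))
      C≡ : C ≡ (V ∪ ⁅ u ⁆) ∪ ⁅ c ⁆
      C≡ = ≡.trans (≡.sym (x∈p⇒p-x∪⁅x⁆≡p c∈C)) (cong (_∪ ⁅ c ⁆) C-c≡V∪u)
      u∉V : u ∉ V
      u∉V = x∉p-x (C - c) u
      c∉V : c ∉ V
      c∉V c∈V = x∉p-x C c (p─q⊆p (C - c) ⁅ u ⁆ c∈V)
      pair : term c + term u ≈ 0#
      pair = trans (reflexive (cong₂ (λ X Y → sign (below C c) * ν X + sign (below C u) * ν Y) C-c≡V∪u C-u≡V∪c))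
                   (subst (λ X → sign (below X c) * ν (V ∪ ⁅ u ⁆) + sign (below X u) * ν (V ∪ ⁅ c ⁆) ≈ 0#) (≡.sym C≡)
                          (swapped-terms-cancel {ν} swap V c≢u c∉V u∉V same))

  ideal-vanishing : ∀ {ν} → LevelCompatible ν → VanishesAbove ν → ∀ {y} → Exterior.InI R n G y → ⟨ ν ∣ y ⟩ ≈ 0#
  ideal-vanishing {ν} compatible above (gs , dependent , y≈) =
    trans (⟨∣⟩-cong ν y≈) (⟨∣sumE⟩-vanishing ν _ dependent λ {(a , C , b)} → generator a C b)
    where
    open Exterior R n using (∂e) renaming (_∧_ to _∧ᴱ_)
    generator : ∀ a C b → Dependent G C → ⟨ ν ∣ (a ∧ᴱ ∂e C) ∧ᴱ b ⟩ ≈ 0#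
    generator a C b C-dependent = begin
      ⟨ ν ∣ (a ∧ᴱ ∂e C) ∧ᴱ b ⟩    ≈⟨ ⟨∣∧⟩≈⟨▷∣⟩ ν (a ∧ᴱ ∂e C) b ⟩
      ⟨ ν ▷ b ∣ a ∧ᴱ ∂e C ⟩       ≈⟨ ⟨∣∧⟩≈⟨◁∣⟩ (ν ▷ b) a (∂e C) ⟩
      ⟨ ν ▷ b ◁ a ∣ ∂e C ⟩        ≈⟨ ∂-vanishing (◁-compatible (▷-compatible compatible b) a)
                                                  (◁-vanishesAbove (▷-vanishesAbove above b) a) C C-dependent ⟩
      0#                          ∎

  φ-vanishes-on-J : ∀ {x} → Exterior.InJ R n G r x → ⟨ φ ∣ x ⟩ ≈ 0#
  φ-vanishes-on-J (gs , generators , x≈) =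
    trans (⟨∣⟩-cong φ x≈) (⟨∣sumE⟩-vanishing φ _ generators λ {(a , y , b)} (y∈I , low) → generator a y b y∈I low)
    where
    open Exterior R n using (InI; DegLe) renaming (_∧_ to _∧ᴱ_)
    generator : ∀ a y b → InI G y → DegLe r y → ⟨ φ ∣ (a ∧ᴱ y) ∧ᴱ b ⟩ ≈ 0#
    generator a y b y∈I low = begin
      ⟨ φ ∣ (a ∧ᴱ y) ∧ᴱ b ⟩              ≈⟨ ⟨∣∧⟩≈⟨▷∣⟩ φ (a ∧ᴱ y) b ⟩
      ⟨ φ ▷ b ∣ a ∧ᴱ y ⟩                 ≈⟨ ⟨∣∧⟩≈⟨◁∣⟩ (φ ▷ b) a y ⟩
      ⟨ φ ▷ b ◁ a ∣ y ⟩                  ≈⟨ ⟨truncate∣⟩ (φ ▷ b ◁ a) low ⟨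
      ⟨ truncate (φ ▷ b ◁ a) ∣ y ⟩       ≈⟨ ideal-vanishing (truncate-compatible (◁-compatible (▷-compatible φ-compatible b) a))
                                                            (truncate-vanishesAbove _) y∈I ⟩
      0#                                 ∎

  S-transversal : Transversal S
  S-transversal = record
    { injective = λ x∈S y∈S same →
        Finₚ.toℕ-injective (ℕₚ.suc-injective (≡.trans (≡.sym (level-∈S x∈S)) (≡.trans same (level-∈S y∈S))))
    ; covers    = λ {s} s∈S → s , s∈S , level-∈S s∈S
    }

  transversal-precedes : ∀ {T} → T ≢ S → Transversal T → colexRank T ℕ.< colexRank S
  transversal-precedes T≢S t with highest-difference T≢S
  ... | x , inj₁ (x∈T , x∉S) , agree = colexRank-< x∈T x∉S agree
  ... | x , inj₂ (x∉T , x∈S) , agree with Transversal.covers t x∈S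
  ...   | y , y∈T , level-y =
    ⊥-elim (y≢x (Finₚ.toℕ-injective (ℕₚ.suc-injective (≡.trans (≡.sym (level-∈S y∈S)) level-y))))
    where
    y≢x : y ≢ x
    y≢x refl = x∉T y∈T
    x<y : x Fin.< y
    x<y = ℕₚ.≤∧≢⇒< (closureFrom-above x∈S (level⇒closureFrom x∈S (ℕₚ.≤-reflexive (≡.sym level-y))))
                   (y≢x ∘ ≡.sym ∘ Finₚ.toℕ-injective)
    y∈S : y ∈ S
    y∈S = proj₁ (agree x<y) y∈T

  φ-S : φ S ≡ sign (levelInversions S)
  φ-S with transversal? S
  ... | yes _ = refl
  ... | no ¬t = ⊥-elim (¬t S-transversal)

  coefficient-vanishes : ∀ coef → Exterior.InJ R n G r (Exterior.linComb R n coef) →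
                         (∀ T → colexRank T ℕ.< colexRank S → coef T ≈ 0#) → coef S ≈ 0#
  coefficient-vanishes coef inJ earlier = begin
    coef S                                       ≈⟨ *-identityʳ _ ⟨
    coef S * 1#                                  ≈⟨ *-congˡ (sign*sign≈1 (levelInversions S)) ⟨
    coef S * (sign b * sign b)                   ≈⟨ *-assoc _ _ _ ⟨
    (coef S * sign b) * sign b                   ≈⟨ *-congʳ coef*φ ⟩
    0# * sign b                                  ≈⟨ zeroˡ _ ⟩
    0#                                           ∎
    where
    b : Bool
    b = levelInversions S
    others : ∀ T → T ≢ S → coef T * φ T ≈ 0#
    others T T≢S with transversal? T
    ... | yes t = trans (*-congʳ (earlier T (transversal-precedes T≢S t))) (zeroˡ _)
    ... | no  _ = zeroʳ _
    coef*φ : coef S * sign b ≈ 0#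
    coef*φ = begin
      coef S * sign b                            ≡⟨ cong (coef S *_) φ-S ⟨
      coef S * φ S                               ≈⟨ ∑-allSubsets-one (λ T → coef T * φ T) S others ⟨
      ∑[ T ← allSubsets n ] coef T * φ T         ≈⟨ ⟨∣linComb⟩ φ coef ⟨
      ⟨ φ ∣ Exterior.linComb R n coef ⟩          ≈⟨ φ-vanishes-on-J inJ ⟩
      0#                                         ∎

theorem2p25 : ∀ {c ℓ : Level} (R : CommutativeRing c ℓ) (n : ℕ) (G : Matroid n)
    → Loopless G → NoMultiplePoints G
    → (r : ℕ) → 1 ≤ r
    → (coef : Subset n → CommutativeRing.Carrier R)
    → (∀ S → ¬ NBB G r S → CommutativeRing._≈_ R (coef S) (CommutativeRing.0# R))
    → Exterior.InJ R n G r (Exterior.linComb R n coef)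
    → ∀ S → CommutativeRing._≈_ R (coef S) (CommutativeRing.0# R)
theorem2p25 {ℓ = ℓ} R n G loopless _ r _ coef non-nbb-vanish inJ S = <-rec Goal step (colexRank S) S refl
  where
  open CommutativeRing R using (_≈_; 0#)
  Goal : ℕ → Set ℓ
  Goal k = ∀ S → colexRank S ≡ k → coef S ≈ 0#
  step : ∀ k → (∀ {j} → j ℕ.< k → Goal j) → Goal k
  step k earlier S refl with Decide.nbb? G r S
  ... | no  ¬nbb = non-nbb-vanish S ¬nbb
  ... | yes nbb  = DualFunctional.coefficient-vanishes R G loopless r S nbb coef inJ (λ T T<S → earlier T<S T refl)
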